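{- Let $m\ge s\ge 1$ be integers and let $\Pi$ be a projective plane of order $q=2^m$. Let $S$ be a maximal arc of degree $2^s$ in $\Pi$ (so $|S|=n:=2^{m+s}-2^m+2^s$), and let $D$ be the associated Steiner $2$-$(n,2^s,1)$ design, whose points are the points of $S$ and whose blocks are the nonempty intersections of lines of $\Pi$ with $S$. Let $A$ be the incidence matrix of $D$, $C$ the binary linear code of length $n$ spanned by the rows of $A$, and let $d$ and $d^\perp$ denote the minimum distances of $C$ and $C^\perp$ respectively. (a) $d^\perp=2^m+2$ if the point set of $D$ contains a hyperoval of $\Pi$, and $d^\perp\ge 2^m+4$ otherwise. (b) $d$ is an even number with $d\le 2^s$. If $d=2^s$, then \[ 1+\left\lceil \log_2\Big(\sum_{i=0}^{t}\binom{n-1}{i}\Big)\right\rceil \le \mathrm{rank}_2 A \le n-1-\left\lfloor \log_2\Big(\sum_{i=0}^{2^{s-1}-1}\binom{n-1}{i}\Big)\right\rfloor, \] where $t=2^{m-1}$ if the point set of $D$ contains a hyperoval of $\Pi$, and $t=d^\perp/2-1\ge 2^{m-1}+1$ if it contains no hyperoval of $\Pi$.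
   Context: A projective plane of order $q$ is a Steiner $2$-$(q^2+q+1,q+1,1)$ design (points and lines, any two points on exactly one line). An $(m',k)$-arc in a projective plane of order $q$ is a set of $m'$ points such that every line contains at most $k$ of them; it is maximal if $m'=qk+k-q$, equivalently every line meets it in $0$ or $k$ points. A hyperoval of $\Pi$ is a maximal arc of degree $2$, i.e. a set of $q+2$ points meeting every line in $0$ or $2$ points. The incidence matrix of a design has rows indexed by blocks, columns by points, with entry $1$ iff the block contains the point; $\mathrm{rank}_2 A$ is its rank over $GF(2)$, which equals the dimension of $C$. $C^\perp$ is the dual code of $C$ with respect to the standard inner product over $GF(2)$. -}

module Defs where

open import Data.Nat using (ℕ; zero; suc; _+_; _*_; _∸_; _^_; _≤_; _<_; _/_)
open import Data.Nat.Divisibility using (_∣_)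
open import Data.Nat.Logarithm using (⌊log₂_⌋; ⌈log₂_⌉)
open import Data.Nat.Combinatorics using (_C_)
open import Data.Bool using (Bool; true; false; _∧_; _xor_; if_then_else_)
open import Data.Fin using (Fin)
open import Data.List using (map; upTo)
open import Data.Nat.ListAction using (sum)
open import Data.Product using (Σ; _×_; ∃; _,_)
open import Data.Sum using (_⊎_)
open import Relation.Nullary using (¬_)
open import Relation.Binary.PropositionalEquality using (_≡_; _≢_)

count : {n : ℕ} → (Fin n → Bool) → ℕ
count {zero} f = 0
count {suc n} f = (if f Fin.zero then 1 else 0) + count (λ i → f (Fin.suc i))

xorSum : {n : ℕ} → (Fin n → Bool) → Bool
xorSum {zero} f = false
xorSum {suc n} f = f Fin.zero xor xorSum (λ i → f (Fin.suc i))

sumUpTo : ℕ → (ℕ → ℕ) → ℕ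
sumUpTo t f = sum (map f (upTo (suc t)))

-- A projective plane of order q: a Steiner 2-(q²+q+1, q+1, 1) design.
record ProjectivePlane (q : ℕ) : Set where
  field
    nLines   : ℕ
    I        : Fin nLines → Fin (q * q + q + 1) → Bool
    lineSize : ∀ L → count (I L) ≡ suc q
    twoPts   : ∀ p p' → p ≢ p' →
               Σ (Fin nLines) λ L → (I L p ≡ true) × (I L p' ≡ true) ×
                 (∀ L' → I L' p ≡ true → I L' p' ≡ true → L' ≡ L)
    distinct : ∀ L L' → (∀ p → I L p ≡ I L' p) → L ≡ L'

module _ {q : ℕ} (Π : ProjectivePlane q) where
  open ProjectivePlane Π

  Pt : Set
  Pt = Fin (q * q + q + 1)

  PtSet : Set
  PtSet = Pt → Bool

  _⊆_ : PtSet → PtSet → Set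
  X ⊆ Y = ∀ p → X p ≡ true → Y p ≡ true

  meet : Fin nLines → PtSet → ℕ
  meet L X = count (λ p → I L p ∧ X p)

  IsMaximalArc : ℕ → PtSet → Set
  IsMaximalArc k S = (count S ≡ q * k + k ∸ q) × (∀ L → meet L S ≤ k)

  IsHyperoval : PtSet → Set
  IsHyperoval H = (count H ≡ q + 2) × (∀ L → (meet L H ≡ 0) ⊎ (meet L H ≡ 2))

  module ArcDesign (S : PtSet) where
    IsBlock : Fin nLines → Set
    IsBlock L = 0 < meet L S

    -- row of the incidence matrix A for block L ∩ S (columns: points of S;
    -- vectors of length n are encoded as Boolean functions on Pt vanishing off S)
    row : Fin nLines → PtSet
    row L p = I L p ∧ S p

    Vector : Set
    Vector = Pt → Bool

    SupportedOnS : Vector → Set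
    SupportedOnS x = ∀ p → S p ≡ false → x p ≡ false

    Nonzero : Vector → Set
    Nonzero x = ¬ (∀ p → x p ≡ false)

    weight : Vector → ℕ
    weight = count

    InC : Vector → Set
    InC c = Σ (Fin nLines → Bool) λ T → (∀ L → T L ≡ true → IsBlock L) ×
              (∀ p → c p ≡ xorSum (λ L → T L ∧ row L p))

    InC⊥ : Vector → Set
    InC⊥ x = SupportedOnS x ×
             (∀ L → IsBlock L → xorSum (λ p → x p ∧ row L p) ≡ false)

    IsMinDist : (Vector → Set) → ℕ → Set
    IsMinDist P d = (Σ Vector λ c → P c × Nonzero c × (weight c ≡ d)) ×
                    (∀ c → P c → Nonzero c → d ≤ weight c)

    IsRank₂ : ℕ → Set
    IsRank₂ r = Σ (Fin r → Fin nLines) λ rs →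
      (∀ i → IsBlock (rs i)) ×
      (∀ (T : Fin r → Bool) → (∀ p → xorSum (λ i → T i ∧ row (rs i) p) ≡ false) →
         ∀ i → T i ≡ false) ×
      (∀ L → IsBlock L → Σ (Fin r → Bool) λ T →
         ∀ p → row L p ≡ xorSum (λ i → T i ∧ row (rs i) p))

    ContainsHyperoval : Set
    ContainsHyperoval = Σ PtSet λ H → (H ⊆ S) × IsHyperoval H

module Submission where

-- Every line meets the maximal arc S in 0 or 2ˢ points and every point lies on the odd
-- number q + 1 of lines, so S (as a word) lies in C ∩ C⊥ and all words of C and of C⊥ have even
-- weight. A nonzero word of C⊥ meets each line through a point of its support in a second point,
-- so its weight is at least q + 2, with equality exactly for hyperovals, since three collinear
-- support points would force weight q + 3; weight q + 3 itself is odd. This gives (a); the rows of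
-- A are words of C of weight 2ˢ, whence d ≤ 2ˢ. The rank bounds are sphere-packing bounds on the
-- n - 1 coordinates left after deleting a point of S: the 2ʳ words of C are at mutual distance
-- ≥ 2ˢ, and the at least 2ⁿ⁻ʳ words of C⊥ are at mutual distance ≥ d⊥.

open import Defs
open import Algebra.Bundles using (CommutativeRing)
open import Data.Bool using (Bool; true; false; T; _∧_; _∨_; _xor_; not; if_then_else_)
import Data.Bool as Bool
open import Data.Bool.Properties
  using (∧-assoc; ∧-comm; ∧-identityʳ; ∧-zeroʳ; ∧-conicalˡ; ∧-conicalʳ; ∧-distribʳ-xor;
         xor-identityʳ; xor-same; not-involutive; xor-∧-commutativeRing)
open import Algebra.Properties.CommutativeSemigroup (CommutativeRing.+-commutativeSemigroup xor-∧-commutativeRing)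
  using () renaming (interchange to xor-interchange)
open import Data.Empty using (⊥-elim)
open import Data.Fin using (Fin; zero; suc)
open import Data.Fin.Properties using (_≟_; all?)
import Data.Fin.Properties as Fin
open import Data.List using (List; []; _∷_; map; upTo; applyUpTo; _++_; allFin)
open import Data.List.Membership.Propositional using (_∈_)
open import Data.List.Membership.Propositional.Properties using (∈-allFin)
open import Data.List.Properties using (map-upTo; applyUpTo-∷ʳ)
open import Data.List.Relation.Unary.Any using (here; there)
open import Data.Nat
  using (ℕ; zero; suc; _+_; _*_; _∸_; _^_; _/_; _≤_; _<_; z≤n; s≤s; _≤?_; _<?_; _≤ᵇ_; _≡ᵇ_;
         NonZero; >-nonZero; ≢-nonZero⁻¹)
open import Data.Nat.Combinatorics using (_C_; nCk≡nC[n∸k]; nCn≡1; nCk+nC[k+1]≡[n+1]C[k+1])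
open import Data.Nat.Divisibility using (_∣_; divides)
open import Data.Nat.DivMod using (m/n*n≤m; /-mono-≤; m*n/n≡m)
open import Data.Nat.ListAction using (sum)
open import Data.Nat.ListAction.Properties using (sum-++)
open import Data.Nat.Logarithm
open import Data.Nat.Properties hiding (_≟_)
open import Data.Nat.Solver using (module +-*-Solver)
open +-*-Solver using (solve; _:+_; _:*_; _:=_; con)
open import Data.Product using (Σ; ∃; _×_; _,_; proj₁; proj₂)
open import Data.Sum using (_⊎_; inj₁; inj₂)
open import Data.Vec using (Vec; []; _∷_; lookup; tabulate; take; drop; zipWith)
open import Data.Vec.Functional using () renaming (_∷_ to _∷ᶠ_)
open import Data.Vec.Properties using (lookup∘tabulate; tabulate∘lookup; tabulate-cong; ≡-dec; take++drop≡id; lookup-zipWith)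
open import Relation.Binary.PropositionalEquality
open import Relation.Nullary using (¬_; Dec; yes; no; does; contradiction)
open import Relation.Nullary.Decidable using (dec-true; dec-false; ¬?; _×-dec_; _→-dec_)

-- Parity and counting over Fin n

+-interchange : ∀ a b c d → a + b + (c + d) ≡ a + c + (b + d)
+-interchange a b c d = solve 4 (λ a b c d → a :+ b :+ (c :+ d) := a :+ c :+ (b :+ d)) refl a b c d

parity : ℕ → Bool
parity zero = false
parity (suc n) = not (parity n)

parity-+ : ∀ a b → parity (a + b) ≡ parity a xor parity b
parity-+ zero b = refl
parity-+ (suc a) b rewrite parity-+ a b with parity a
... | true = not-involutive (parity b)
... | false = refl

parity≡false⇒2∣ : ∀ n → parity n ≡ false → 2 ∣ n
parity≡false⇒2∣ zero _ = divides 0 refl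
parity≡false⇒2∣ (suc (suc n)) e with parity≡false⇒2∣ n (trans (sym (not-involutive (parity n))) e)
... | divides k refl = divides (suc k) refl

parity-2^ : ∀ m → 1 ≤ m → parity (2 ^ m) ≡ false
parity-2^ (suc m) _ = trans (cong parity (cong (2 ^ m +_) (+-identityʳ (2 ^ m))))
  (trans (parity-+ (2 ^ m) (2 ^ m)) (xor-same (parity (2 ^ m))))

parity≡true⇒>0 : ∀ n → parity n ≡ true → 0 < n
parity≡true⇒>0 (suc n) _ = s≤s z≤n

parity≡false-≤2 : ∀ n → n ≤ 2 → parity n ≡ false → (n ≡ 0) ⊎ (n ≡ 2)
parity≡false-≤2 zero _ _ = inj₁ refl
parity≡false-≤2 (suc (suc zero)) _ _ = inj₂ refl
parity≡false-≤2 (suc (suc (suc n))) (s≤s (s≤s ())) _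

xor≡false⇒≡ : ∀ {a b} → a xor b ≡ false → a ≡ b
xor≡false⇒≡ {true} {true} _ = refl
xor≡false⇒≡ {false} {false} _ = refl

xor-cancelˡ : ∀ a {b c} → a xor b ≡ a xor c → b ≡ c
xor-cancelˡ false e = e
xor-cancelˡ true {b} {c} e = trans (sym (not-involutive b)) (trans (cong not e) (not-involutive c))

does-true⇒ : ∀ {A : Set} (a? : Dec A) → does a? ≡ true → A
does-true⇒ (yes a) _ = a

_≠ᵇ_ : ∀ {n} → Fin n → Fin n → Bool
i ≠ᵇ j = not (does (i ≟ j))

≠ᵇ⇒≢ : ∀ {n} (i j : Fin n) → i ≠ᵇ j ≡ true → i ≢ j
≠ᵇ⇒≢ i j e refl = contradiction (trans (sym (cong not (dec-true (i ≟ i) refl))) e) λ ()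

≢⇒≠ᵇ : ∀ {n} (i j : Fin n) → i ≢ j → i ≠ᵇ j ≡ true
≢⇒≠ᵇ i j ne = cong not (dec-false (i ≟ j) ne)

≠ᵇ-irrefl : ∀ {n} (i : Fin n) → i ≠ᵇ i ≡ false
≠ᵇ-irrefl i = cong not (dec-true (i ≟ i) refl)

_∖_ : ∀ {n} → (Fin n → Bool) → Fin n → Fin n → Bool
(f ∖ k) i = f i ∧ i ≠ᵇ k

∖-true : ∀ {n} (f : Fin n → Bool) {k z} → f z ≡ true → z ≢ k → (f ∖ k) z ≡ true
∖-true f {k} {z} fz z≢k = cong₂ _∧_ fz (≢⇒≠ᵇ z k z≢k)

count-cong : ∀ {n} {f g : Fin n → Bool} → (∀ i → f i ≡ g i) → count f ≡ count g
count-cong {zero} e = refl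
count-cong {suc n} e rewrite e zero = cong (_ +_) (count-cong (λ i → e (suc i)))

count-none : ∀ {n} (f : Fin n → Bool) → (∀ i → f i ≡ false) → count f ≡ 0
count-none {zero} f e = refl
count-none {suc n} f e rewrite e zero = count-none _ (λ i → e (suc i))

count-all : ∀ {n} (f : Fin n → Bool) → (∀ i → f i ≡ true) → count f ≡ n
count-all {zero} f e = refl
count-all {suc n} f e rewrite e zero = cong suc (count-all _ (λ i → e (suc i)))

count>0⇒witness : ∀ {n} (f : Fin n → Bool) → 0 < count f → ∃ λ i → f i ≡ true
count>0⇒witness {suc n} f p with f zero in eq
... | true = zero , eq
... | false with count>0⇒witness (λ i → f (suc i)) p
... | i , e = suc i , e

count-split : ∀ {n} (f g : Fin n → Bool) →
  count f ≡ count (λ i → f i ∧ g i) + count (λ i → f i ∧ not (g i))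
count-split {zero} f g = refl
count-split {suc n} f g with f zero | g zero
... | false | _ = count-split (λ i → f (suc i)) (λ i → g (suc i))
... | true | true = cong suc (count-split (λ i → f (suc i)) (λ i → g (suc i)))
... | true | false = trans (cong suc (count-split (λ i → f (suc i)) (λ i → g (suc i)))) (sym (+-suc _ _))

count-mono : ∀ {n} (f g : Fin n → Bool) → (∀ i → f i ≡ true → g i ≡ true) → count f ≤ count g
count-mono {zero} f g h = z≤n
count-mono {suc n} f g h with f zero in ef | g zero in eg
... | false | false = count-mono _ _ (λ i → h (suc i))
... | false | true = m≤n⇒m≤1+n (count-mono _ _ (λ i → h (suc i)))
... | true | true = s≤s (count-mono _ _ (λ i → h (suc i)))
... | true | false with trans (sym eg) (h zero ef)
... | ()

count-∨ : ∀ {n} (f g : Fin n → Bool) → count (λ i → f i ∨ g i) ≤ count f + count g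
count-∨ {zero} f g = z≤n
count-∨ {suc n} f g with f zero | g zero
... | false | false = count-∨ (λ i → f (suc i)) (λ i → g (suc i))
... | false | true = ≤-trans (s≤s (count-∨ (λ i → f (suc i)) (λ i → g (suc i)))) (≤-reflexive (sym (+-suc _ _)))
... | true | false = s≤s (count-∨ (λ i → f (suc i)) (λ i → g (suc i)))
... | true | true = s≤s (≤-trans (count-∨ (λ i → f (suc i)) (λ i → g (suc i))) (+-monoʳ-≤ _ (n≤1+n _)))

count-singleton : ∀ {n} (P : Fin n → Bool) k → P k ≡ true → (∀ i → P i ≡ true → i ≡ k) → count P ≡ 1
count-singleton P zero pk u rewrite pk = cong suc (count-none _ rest)
  where
  rest : ∀ i → P (suc i) ≡ false
  rest i with P (suc i) in e
  ... | false = refl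
  ... | true with u (suc i) e
  ... | ()
count-singleton P (suc k) pk u with P zero in e
... | true with u zero e
... | ()
count-singleton P (suc k) pk u | false =
  count-singleton (λ i → P (suc i)) k pk (λ i pi → Fin.suc-injective (u (suc i) pi))

count-remove : ∀ {n} (f : Fin n → Bool) k → f k ≡ true → count f ≡ suc (count (f ∖ k))
count-remove f k fk = trans (count-split f (λ i → does (i ≟ k)))
  (cong (_+ count (f ∖ k)) (count-singleton _ k (trans (cong (_∧ does (k ≟ k)) fk) (dec-true (k ≟ k) refl))
     (λ i e → does-true⇒ (i ≟ k) (∧-conicalʳ (f i) _ e))))

witness⇒count>0 : ∀ {n} (f : Fin n → Bool) k → f k ≡ true → 0 < count f
witness⇒count>0 f k e rewrite count-remove f k e = s≤s z≤n

count≡0⇒none : ∀ {n} (f : Fin n → Bool) → count f ≡ 0 → ∀ i → f i ≡ false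
count≡0⇒none f c i with f i in e
... | false = refl
... | true with trans (sym c) (count-remove f i e)
... | ()

¬none⇒witness : ∀ {n} (f : Fin n → Bool) → ¬ (∀ i → f i ≡ false) → ∃ λ i → f i ≡ true
¬none⇒witness f ¬none with count f in e
... | zero = ⊥-elim (¬none (count≡0⇒none f e))
... | suc _ = count>0⇒witness f (subst (0 <_) (sym e) (s≤s z≤n))

count-injection : ∀ {a b} (P : Fin a → Bool) (Q : Fin b → Bool) (f : Fin a → Fin b) →
  (∀ i → P i ≡ true → Q (f i) ≡ true) →
  (∀ i j → P i ≡ true → P j ≡ true → f i ≡ f j → i ≡ j) → count P ≤ count Q
count-injection {zero} P Q f into inj = z≤n
count-injection {suc a} P Q f into inj with P zero in e
... | false = count-injection (λ i → P (suc i)) Q (λ i → f (suc i)) (λ i → into (suc i))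
                (λ i j pi pj fe → Fin.suc-injective (inj (suc i) (suc j) pi pj fe))
... | true = subst (suc (count (λ i → P (suc i))) ≤_) (sym (count-remove Q (f zero) (into zero e)))
               (s≤s (count-injection (λ i → P (suc i)) (Q ∖ f zero) (λ i → f (suc i))
                 (λ i pi → ∖-true Q (into (suc i) pi) (λ fe → contradiction (inj (suc i) zero pi e fe) λ ()))
                 (λ i j pi pj fe → Fin.suc-injective (inj (suc i) (suc j) pi pj fe))))

three-witnesses : ∀ {n} (f : Fin n → Bool) → 3 ≤ count f → Σ (Fin n) λ p → Σ (Fin n) λ a → Σ (Fin n) λ b →
  (f p ≡ true) × (f a ≡ true) × (f b ≡ true) × (a ≢ p) × (b ≢ p) × (a ≢ b)
three-witnesses f 3≤ with count>0⇒witness f (≤-trans (s≤s z≤n) 3≤)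
... | p , fp with count>0⇒witness (f ∖ p) (≤-pred (≤-trans (s≤s (s≤s z≤n)) (subst (3 ≤_) (count-remove f p fp) 3≤)))
... | b , hb with count>0⇒witness ((f ∖ p) ∖ b)
       (≤-pred (≤-pred (subst (3 ≤_) (trans (count-remove f p fp) (cong suc (count-remove _ b hb))) 3≤)))
... | a , ha = p , a , b , fp , ∧-conicalˡ _ _ (∧-conicalˡ _ _ ha) , ∧-conicalˡ _ _ hb ,
               ≠ᵇ⇒≢ a p (∧-conicalʳ (f a) _ (∧-conicalˡ _ _ ha)) , ≠ᵇ⇒≢ b p (∧-conicalʳ (f b) _ hb) ,
               ≠ᵇ⇒≢ a b (∧-conicalʳ (f a ∧ a ≠ᵇ p) _ ha)

sumFin : ∀ {n} → (Fin n → ℕ) → ℕ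
sumFin {zero} f = 0
sumFin {suc n} f = f zero + sumFin (λ i → f (suc i))

sumFin-cong : ∀ {n} {f g : Fin n → ℕ} → (∀ i → f i ≡ g i) → sumFin f ≡ sumFin g
sumFin-cong {zero} e = refl
sumFin-cong {suc n} e = cong₂ _+_ (e zero) (sumFin-cong (λ i → e (suc i)))

sumFin-zero : ∀ n → sumFin {n} (λ _ → 0) ≡ 0
sumFin-zero zero = refl
sumFin-zero (suc n) = sumFin-zero n

sumFin-+ : ∀ {n} (f g : Fin n → ℕ) → sumFin (λ i → f i + g i) ≡ sumFin f + sumFin g
sumFin-+ {zero} f g = refl
sumFin-+ {suc n} f g = trans (cong (f zero + g zero +_) (sumFin-+ (λ i → f (suc i)) (λ i → g (suc i))))
  (+-interchange (f zero) (g zero) _ _)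

sumFin-swap : ∀ {a b} (g : Fin a → Fin b → ℕ) →
  sumFin (λ i → sumFin (λ j → g i j)) ≡ sumFin (λ j → sumFin (λ i → g i j))
sumFin-swap {zero} {b} g = sym (sumFin-zero b)
sumFin-swap {suc a} g = trans (cong (sumFin (g zero) +_) (sumFin-swap (λ i → g (suc i))))
  (sym (sumFin-+ (g zero) (λ j → sumFin (λ i → g (suc i) j))))

count≡sumFin : ∀ {n} (f : Fin n → Bool) → count f ≡ sumFin (λ i → if f i then 1 else 0)
count≡sumFin {zero} f = refl
count≡sumFin {suc n} f = cong ((if f zero then 1 else 0) +_) (count≡sumFin (λ i → f (suc i)))

sumFin-if : ∀ {n} (P : Fin n → Bool) c → sumFin (λ i → if P i then c else 0) ≡ c * count P
sumFin-if {zero} P c = sym (*-zeroʳ c)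
sumFin-if {suc n} P c with P zero
... | true = trans (cong (c +_) (sumFin-if (λ i → P (suc i)) c)) (sym (*-suc c _))
... | false = sumFin-if (λ i → P (suc i)) c

sumFin-mono : ∀ {n} (f g : Fin n → ℕ) → (∀ i → f i ≤ g i) → sumFin f ≤ sumFin g
sumFin-mono {zero} f g le = z≤n
sumFin-mono {suc n} f g le = +-mono-≤ (le zero) (sumFin-mono _ _ (λ i → le (suc i)))

sumFin-≤-≡ : ∀ {n} (f g : Fin n → ℕ) → (∀ i → f i ≤ g i) → sumFin f ≡ sumFin g → ∀ i → f i ≡ g i
sumFin-≤-≡ {suc n} f g le e zero =
  ≤-antisym (le zero) (+-cancelʳ-≤ _ _ _ (≤-trans (≤-reflexive (sym e))
    (+-monoʳ-≤ (f zero) (sumFin-mono _ _ (λ i → le (suc i))))))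
sumFin-≤-≡ {suc n} f g le e (suc i) =
  sumFin-≤-≡ _ _ (λ i → le (suc i))
    (+-cancelˡ-≡ (f zero) _ _ (trans e (cong (_+ _) (sym (sumFin-≤-≡ f g le e zero))))) i

xorSum-cong : ∀ {n} {f g : Fin n → Bool} → (∀ i → f i ≡ g i) → xorSum f ≡ xorSum g
xorSum-cong {zero} e = refl
xorSum-cong {suc n} e = cong₂ _xor_ (e zero) (xorSum-cong (λ i → e (suc i)))

xorSum≡parity∘count : ∀ {n} (f : Fin n → Bool) → xorSum f ≡ parity (count f)
xorSum≡parity∘count {zero} f = refl
xorSum≡parity∘count {suc n} f with f zero
... | true = cong not (xorSum≡parity∘count (λ i → f (suc i)))
... | false = xorSum≡parity∘count (λ i → f (suc i))

xorSum-none : ∀ {n} (f : Fin n → Bool) → (∀ i → f i ≡ false) → xorSum f ≡ false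
xorSum-none f e = trans (xorSum≡parity∘count f) (cong parity (count-none f e))

xorSum-xor : ∀ {n} (f g : Fin n → Bool) → xorSum (λ i → f i xor g i) ≡ xorSum f xor xorSum g
xorSum-xor {zero} f g = refl
xorSum-xor {suc n} f g = trans (cong ((f zero xor g zero) xor_) (xorSum-xor (λ i → f (suc i)) (λ i → g (suc i))))
  (xor-interchange (f zero) (g zero) _ _)

xorSum-∧ˡ : ∀ {n} a (f : Fin n → Bool) → xorSum (λ i → a ∧ f i) ≡ a ∧ xorSum f
xorSum-∧ˡ true f = refl
xorSum-∧ˡ false f = xorSum-none (λ i → false ∧ f i) (λ _ → refl)

xorSum-∧ʳ : ∀ {n} (f : Fin n → Bool) b → xorSum (λ i → f i ∧ b) ≡ xorSum f ∧ b
xorSum-∧ʳ f b = trans (xorSum-cong (λ i → ∧-comm (f i) b)) (trans (xorSum-∧ˡ b f) (∧-comm b (xorSum f)))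

xorSum-swap : ∀ {a b} (g : Fin a → Fin b → Bool) →
  xorSum (λ i → xorSum (λ j → g i j)) ≡ xorSum (λ j → xorSum (λ i → g i j))
xorSum-swap {zero} {b} g = sym (xorSum-none {b} (λ _ → false) (λ _ → refl))
xorSum-swap {suc a} g = trans (cong (xorSum (g zero) xor_) (xorSum-swap (λ i → g (suc i))))
  (sym (xorSum-xor (g zero) (λ j → xorSum (λ i → g (suc i) j))))

xorSum-select : ∀ {n} k (g : Fin n → Bool) → xorSum (λ i → does (i ≟ k) ∧ g i) ≡ g k
xorSum-select k g = trans (xorSum≡parity∘count (λ i → does (i ≟ k) ∧ g i)) (select (g k) refl)
  where
  select : ∀ b → g k ≡ b → parity (count (λ i → does (i ≟ k) ∧ g i)) ≡ g k
  select true e = trans (cong parity (count-singleton _ k (trans (cong (_∧ g k) (dec-true (k ≟ k) refl)) e)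
                    (λ i h → does-true⇒ (i ≟ k) (∧-conicalˡ _ _ h)))) (sym e)
  select false e = trans (cong parity (count-none _ off)) (sym e)
    where
    off : ∀ i → does (i ≟ k) ∧ g i ≡ false
    off i with i ≟ k
    ... | yes refl = e
    ... | no _ = refl

_·_ : ∀ {n} → (Fin n → Bool) → (Fin n → Bool) → Bool
x · y = xorSum (λ i → x i ∧ y i)

·-xorˡ : ∀ {n} (a b c : Fin n → Bool) → (λ i → a i xor b i) · c ≡ (a · c) xor (b · c)
·-xorˡ a b c = trans (xorSum-cong (λ i → ∧-distribʳ-xor (c i) (a i) (b i))) (xorSum-xor (λ i → a i ∧ c i) (λ i → b i ∧ c i))

xorSum-combination : ∀ {a b} (T : Fin a → Bool) (U : Fin a → Fin b → Bool) (v : Fin b → Bool) →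
  xorSum (λ j → T j ∧ xorSum (λ i → U j i ∧ v i)) ≡ xorSum (λ i → xorSum (λ j → T j ∧ U j i) ∧ v i)
xorSum-combination T U v = begin
    xorSum (λ j → T j ∧ xorSum (λ i → U j i ∧ v i))
  ≡⟨ xorSum-cong (λ j → sym (xorSum-∧ˡ (T j) (λ i → U j i ∧ v i))) ⟩
    xorSum (λ j → xorSum (λ i → T j ∧ (U j i ∧ v i)))
  ≡⟨ xorSum-swap (λ j i → T j ∧ (U j i ∧ v i)) ⟩
    xorSum (λ i → xorSum (λ j → T j ∧ (U j i ∧ v i)))
  ≡⟨ xorSum-cong (λ i → trans (xorSum-cong (λ j → sym (∧-assoc (T j) (U j i) (v i))))
                                (xorSum-∧ʳ (λ j → T j ∧ U j i) (v i))) ⟩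
    xorSum (λ i → xorSum (λ j → T j ∧ U j i) ∧ v i) ∎
  where open ≡-Reasoning

·-combination : ∀ {n m} (x : Fin n → Bool) (T : Fin m → Bool) (r : Fin m → Fin n → Bool) →
  x · (λ p → xorSum (λ j → T j ∧ r j p)) ≡ xorSum (λ j → T j ∧ (x · r j))
·-combination x T r = begin
    xorSum (λ p → x p ∧ xorSum (λ j → T j ∧ r j p))
  ≡⟨ xorSum-cong (λ p → cong (x p ∧_) (xorSum-cong (λ j → ∧-comm (T j) (r j p)))) ⟩
    xorSum (λ p → x p ∧ xorSum (λ j → r j p ∧ T j))
  ≡⟨ xorSum-combination x (λ p j → r j p) T ⟩
    xorSum (λ j → (x · r j) ∧ T j)
  ≡⟨ xorSum-cong (λ j → ∧-comm (x · r j) (T j)) ⟩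
    xorSum (λ j → T j ∧ (x · r j)) ∎
  where open ≡-Reasoning

xorSum≡true⇒witness : ∀ {n} (f : Fin n → Bool) → xorSum f ≡ true → ∃ λ i → f i ≡ true
xorSum≡true⇒witness f e = count>0⇒witness f (parity≡true⇒>0 (count f) (trans (sym (xorSum≡parity∘count f)) e))

xorSum≡false⇒another : ∀ {n} (f : Fin n → Bool) p → xorSum f ≡ false → f p ≡ true →
  ∃ λ z → (z ≢ p) × (f z ≡ true)
xorSum≡false⇒another f p e fp
  with count>0⇒witness (f ∖ p) (parity≡true⇒>0 (count (f ∖ p)) restOdd)
  where
  restOdd : parity (count (f ∖ p)) ≡ true
  restOdd = trans (sym (not-involutive _))
    (cong not (trans (cong parity (sym (count-remove f p fp))) (trans (sym (xorSum≡parity∘count f)) e)))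
... | z , h = z , ≠ᵇ⇒≢ z p (∧-conicalʳ (f z) _ h) , ∧-conicalˡ (f z) _ h

-- Incidences in a projective plane

module _ {q : ℕ} (Π : ProjectivePlane q) where
  open ProjectivePlane Π

  meet-remove : ∀ L X p → I L p ≡ true → X p ≡ true → meet Π L X ≡ suc (meet Π L (X ∖ p))
  meet-remove L X p ip xp = trans (count-remove (λ z → I L z ∧ X z) p (cong₂ _∧_ ip xp))
    (cong suc (count-cong (λ z → ∧-assoc (I L z) (X z) _)))

  lines-through-two : ∀ p z → z ≢ p → count (λ L → I L p ∧ I L z) ≡ 1
  lines-through-two p z z≢p with twoPts p z (λ e → z≢p (sym e))
  ... | L , ip , iz , unique = count-singleton _ L (cong₂ _∧_ ip iz)
        (λ L′ h → unique L′ (∧-conicalˡ _ _ h) (∧-conicalʳ (I L′ p) _ h))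

  same-line : ∀ p z L L′ → z ≢ p → I L p ≡ true → I L z ≡ true → I L′ p ≡ true → I L′ z ≡ true → L ≡ L′
  same-line p z L L′ z≢p a b c d with twoPts p z (λ e → z≢p (sym e))
  ... | _ , _ , _ , unique = trans (unique L a b) (sym (unique L′ c d))

  lines-through≤ : ∀ p (Q : PtSet Π) →
    (∀ L → I L p ≡ true → ∃ λ z → (z ≢ p) × (Q z ≡ true) × (I L z ≡ true)) →
    count (λ L → I L p) ≤ count Q
  lines-through≤ p Q pick = count-injection (λ L → I L p) Q (λ L → proj₁ (pick′ L))
      (λ L e → proj₁ (proj₂ (proj₂ (pick′ L) e)))
      (λ L L′ e e′ same → same-line p _ L L′ (proj₁ (proj₂ (pick′ L) e)) e (proj₂ (proj₂ (proj₂ (pick′ L) e))) e′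
        (subst (λ z → I L′ z ≡ true) (sym same) (proj₂ (proj₂ (proj₂ (pick′ L′) e′)))))
    where
    pick′ : ∀ L → ∃ λ z → I L p ≡ true → (z ≢ p) × (Q z ≡ true) × (I L z ≡ true)
    pick′ L with I L p in e
    ... | true = let (z , h) = pick L e in z , λ _ → h
    ... | false = p , λ ()

  -- Every point of X other than p lies on exactly one line through p.
  sum-meet-lines-through : ∀ p X →
    sumFin (λ L → if I L p then meet Π L (X ∖ p) else 0) ≡ count (X ∖ p)
  sum-meet-lines-through p X = begin
      sumFin (λ L → if I L p then meet Π L (X ∖ p) else 0)
    ≡⟨ sumFin-cong (λ L → flags L (I L p)) ⟩
      sumFin (λ L → sumFin (λ z → if I L p ∧ (I L z ∧ (X ∖ p) z) then 1 else 0))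
    ≡⟨ sumFin-swap (λ L z → if I L p ∧ (I L z ∧ (X ∖ p) z) then 1 else 0) ⟩
      sumFin (λ z → sumFin (λ L → if I L p ∧ (I L z ∧ (X ∖ p) z) then 1 else 0))
    ≡⟨ sumFin-cong (λ z → trans (sym (count≡sumFin (λ L → I L p ∧ (I L z ∧ (X ∖ p) z)))) (lines z ((X ∖ p) z) refl)) ⟩
      sumFin (λ z → if (X ∖ p) z then 1 else 0)
    ≡⟨ sym (count≡sumFin (X ∖ p)) ⟩
      count (X ∖ p) ∎
    where
    open ≡-Reasoning
    flags : ∀ L b → (if b then meet Π L (X ∖ p) else 0) ≡
                    sumFin (λ z → if b ∧ (I L z ∧ (X ∖ p) z) then 1 else 0)
    flags L true = count≡sumFin (λ z → I L z ∧ (X ∖ p) z)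
    flags L false = sym (sumFin-zero (q * q + q + 1))
    lines : ∀ z b → (X ∖ p) z ≡ b →
      count (λ L → I L p ∧ (I L z ∧ (X ∖ p) z)) ≡ (if b then 1 else 0)
    lines z false e = count-none _ (λ L → trans (cong (λ x → I L p ∧ (I L z ∧ x)) e)
                        (trans (cong (I L p ∧_) (∧-zeroʳ (I L z))) (∧-zeroʳ (I L p))))
    lines z true e = trans (count-cong (λ L → cong (λ x → I L p ∧ (I L z ∧ x)) e))
      (trans (count-cong (λ L → cong (I L p ∧_) (∧-identityʳ (I L z))))
        (lines-through-two p z (≠ᵇ⇒≢ z p (∧-conicalʳ (X z) _ e))))

  lines-through-point : .{{_ : NonZero q}} → ∀ p → count (λ L → I L p) ≡ suc q
  lines-through-point p = *-cancelˡ-≡ _ _ q (begin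
      q * count (λ L → I L p)
    ≡⟨ sym (sumFin-if (λ L → I L p) q) ⟩
      sumFin (λ L → if I L p then q else 0)
    ≡⟨ sumFin-cong (λ L → on-line L (I L p) refl) ⟩
      sumFin (λ L → if I L p then meet Π L (everything ∖ p) else 0)
    ≡⟨ sum-meet-lines-through p everything ⟩
      count (everything ∖ p)
    ≡⟨ suc-injective (trans (sym (count-remove everything p refl)) (trans (count-all everything (λ _ → refl)) (+-comm _ 1))) ⟩
      q * q + q
    ≡⟨ solve 1 (λ q → q :* q :+ q := q :* (con 1 :+ q)) refl q ⟩
      q * suc q ∎)
    where
    open ≡-Reasoning
    everything : PtSet Π
    everything _ = true
    on-line : ∀ L b → I L p ≡ b → (if b then q else 0) ≡ (if b then meet Π L (everything ∖ p) else 0)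
    on-line L false _ = refl
    on-line L true ip = suc-injective (begin
        suc q
      ≡⟨ sym (lineSize L) ⟩
        count (I L)
      ≡⟨ count-cong (λ z → sym (∧-identityʳ (I L z))) ⟩
        meet Π L everything
      ≡⟨ meet-remove L everything p ip refl ⟩
        suc (meet Π L (everything ∖ p)) ∎)

  -- Counting S ∖ p along the q + 1 lines through p forces every such line to be full.
  maximalArc-meet : .{{_ : NonZero q}} → ∀ k S → 1 ≤ k → IsMaximalArc Π k S →
    ∀ L → 0 < meet Π L S → meet Π L S ≡ k
  maximalArc-meet (suc k′) S _ (|S| , ≤k) L L∩S≠∅ with count>0⇒witness _ L∩S≠∅
  ... | p , h = trans (meet-remove L S p ip sp) (cong suc (trans (sym (if-true ip)) (trans (full L) (if-true ip))))
    where
    open ≡-Reasoning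
    ip = ∧-conicalˡ _ _ h
    sp = ∧-conicalʳ (I L p) _ h
    if-true : ∀ {b} {x y : ℕ} → b ≡ true → (if b then x else y) ≡ x
    if-true refl = refl
    through : Fin nLines → ℕ
    through L = if I L p then meet Π L (S ∖ p) else 0
    bound : Fin nLines → ℕ
    bound L = if I L p then k′ else 0
    through≤bound : ∀ L → through L ≤ bound L
    through≤bound L with I L p in ip
    ... | false = z≤n
    ... | true = ≤-pred (≤-trans (≤-reflexive (sym (meet-remove L S p ip sp))) (≤k L))
    |S∖p| : count (S ∖ p) ≡ k′ * suc q
    |S∖p| = suc-injective (begin
        suc (count (S ∖ p))
      ≡⟨ sym (count-remove S p sp) ⟩
        count S
      ≡⟨ |S| ⟩
        q * suc k′ + suc k′ ∸ q
      ≡⟨ cong (_∸ q) (solve 2 (λ q k → q :* (con 1 :+ k) :+ (con 1 :+ k) := q :+ (con 1 :+ k :* (con 1 :+ q))) refl q k′) ⟩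
        q + suc (k′ * suc q) ∸ q
      ≡⟨ m+n∸m≡n q _ ⟩
        suc (k′ * suc q) ∎)
    sums : sumFin through ≡ sumFin bound
    sums = begin
        sumFin through
      ≡⟨ sum-meet-lines-through p S ⟩
        count (S ∖ p)
      ≡⟨ trans |S∖p| (cong (k′ *_) (sym (lines-through-point p))) ⟩
        k′ * count (λ L → I L p)
      ≡⟨ sym (sumFin-if (λ L → I L p) k′) ⟩
        sumFin bound ∎
    full : ∀ L → through L ≡ bound L
    full = sumFin-≤-≡ through bound through≤bound sums

-- The code of the arc design and its dual

module _ {q : ℕ} (Π : ProjectivePlane q) (S : PtSet Π) where
  open ProjectivePlane Π
  open ArcDesign Π S

  isBlock? : Fin nLines → Bool
  isBlock? L = does (0 <? meet Π L S)

  isBlock?-sound : ∀ L → isBlock? L ≡ true → IsBlock L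
  isBlock?-sound L = does-true⇒ (0 <? meet Π L S)

  isBlock?-complete : ∀ L → IsBlock L → isBlock? L ≡ true
  isBlock?-complete L = dec-true (0 <? meet Π L S)

  block-through : ∀ L p → I L p ≡ true → S p ≡ true → IsBlock L
  block-through L p ip sp = witness⇒count>0 (λ z → I L z ∧ S z) p (cong₂ _∧_ ip sp)

  supported⇒⊆S : ∀ x → SupportedOnS x → ∀ p → x p ≡ true → S p ≡ true
  supported⇒⊆S x sx p xp with S p in e
  ... | true = refl
  ... | false = trans (sym (sx p e)) xp

  supported-∧S : ∀ x → SupportedOnS x → ∀ p → x p ∧ S p ≡ x p
  supported-∧S x sx p with S p in e
  ... | true = ∧-identityʳ (x p)
  ... | false = trans (∧-zeroʳ (x p)) (sym (sx p e))

  InC⇒supported : ∀ c → InC c → SupportedOnS c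
  InC⇒supported c (T , _ , c≡) p sp = trans (c≡ p)
    (xorSum-none _ (λ L → trans (cong (λ s → T L ∧ (I L p ∧ s)) sp)
                          (trans (cong (T L ∧_) (∧-zeroʳ (I L p))) (∧-zeroʳ (T L)))))

  row-nonzero : ∀ L → IsBlock L → Nonzero (row L)
  row-nonzero L b none = let (p , h) = count>0⇒witness (λ z → I L z ∧ S z) b in contradiction (trans (sym h) (none p)) λ ()

  row∈C : ∀ L → IsBlock L → InC (row L)
  row∈C L b = (λ L′ → does (L′ ≟ L)) , (λ L′ e → subst IsBlock (sym (does-true⇒ (L′ ≟ L) e)) b) ,
    (λ p → sym (xorSum-select L (λ L′ → row L′ p)))

  InC⊥-orthogonal : ∀ c x → InC c → InC⊥ x → x · c ≡ false
  InC⊥-orthogonal c x (T , blocks , c≡) (_ , x⊥) =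
    trans (xorSum-cong (λ p → cong (x p ∧_) (c≡ p)))
      (trans (·-combination x T row) (xorSum-none _ term))
    where
    term : ∀ L → T L ∧ (x · row L) ≡ false
    term L with T L in e
    ... | false = refl
    ... | true = x⊥ L (blocks L e)

  S∈C⊥ : (∀ L → IsBlock L → parity (meet Π L S) ≡ false) → InC⊥ S
  S∈C⊥ even = (λ _ e → e) , λ L b →
    trans (xorSum≡parity∘count (λ p → S p ∧ row L p)) (trans (cong parity (count-cong (λ p → on-S (S p) (I L p)))) (even L b))
    where
    on-S : ∀ s i → s ∧ (i ∧ s) ≡ i ∧ s
    on-S true i = refl
    on-S false i = sym (∧-zeroʳ i)

  S∈C : (∀ p → parity (count (λ L → I L p)) ≡ true) → InC S
  S∈C odd = isBlock? , isBlock?-sound , S≡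
    where
    S≡ : ∀ p → S p ≡ xorSum (λ L → isBlock? L ∧ row L p)
    S≡ p with S p in sp
    ... | false = sym (xorSum-none _ (λ L → trans (cong (isBlock? L ∧_) (∧-zeroʳ (I L p))) (∧-zeroʳ (isBlock? L))))
    ... | true = sym (trans (xorSum-cong term) (trans (xorSum≡parity∘count (λ L → I L p)) (odd p)))
      where
      term : ∀ L → isBlock? L ∧ (I L p ∧ true) ≡ I L p
      term L with I L p in ip
      ... | false = ∧-zeroʳ (isBlock? L)
      ... | true rewrite isBlock?-complete L (block-through L p ip sp) = refl

  InC-even : InC⊥ S → ∀ c → InC c → parity (count c) ≡ false
  InC-even S⊥ c c∈C = trans (sym (xorSum≡parity∘count c))
    (trans (xorSum-cong (λ p → trans (sym (supported-∧S c (InC⇒supported c c∈C) p)) (∧-comm (c p) (S p))))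
      (InC⊥-orthogonal c S c∈C S⊥))

  InC⊥-even : InC S → ∀ x → InC⊥ x → parity (count x) ≡ false
  InC⊥-even S∈ x x∈C⊥ = trans (sym (xorSum≡parity∘count x))
    (trans (xorSum-cong (λ p → sym (supported-∧S x (proj₁ x∈C⊥) p))) (InC⊥-orthogonal S x S∈ x∈C⊥))

  InC⊥-line-meet : ∀ x → InC⊥ x → ∀ L → parity (meet Π L x) ≡ false
  InC⊥-line-meet x (sx , x⊥) L with isBlock? L in bl
  ... | true = trans (cong parity (count-cong (λ z → in-S (I L z) (x z) (supported⇒⊆S x sx z))))
                 (trans (sym (xorSum≡parity∘count (λ z → x z ∧ row L z))) (x⊥ L (isBlock?-sound L bl)))
    where
    in-S : ∀ i b {s} → (b ≡ true → s ≡ true) → i ∧ b ≡ b ∧ (i ∧ s)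
    in-S i false _ = ∧-zeroʳ i
    in-S i true s≡ rewrite s≡ refl = refl
  ... | false = cong parity (n≤0⇒n≡0 (≤-trans (count-mono _ _ within-S) (≮⇒≥ not-block)))
    where
    within-S : ∀ z → I L z ∧ x z ≡ true → I L z ∧ S z ≡ true
    within-S z h = cong₂ _∧_ (∧-conicalˡ _ _ h) (supported⇒⊆S x sx z (∧-conicalʳ (I L z) _ h))
    not-block : ¬ (0 < meet Π L S)
    not-block b = contradiction (trans (sym (isBlock?-complete L b)) bl) λ ()

  another-on-line : ∀ x → InC⊥ x → ∀ p → x p ≡ true → ∀ L → I L p ≡ true →
    ∃ λ z → (z ≢ p) × (x z ≡ true) × (I L z ≡ true)
  another-on-line x (sx , x⊥) p xp L ip
    with xorSum≡false⇒another (λ z → x z ∧ row L z) p (x⊥ L (block-through L p ip sp))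
           (cong₂ _∧_ xp (cong₂ _∧_ ip sp))
    where sp = supported⇒⊆S x sx p xp
  ... | z , z≢p , h = z , z≢p , ∧-conicalˡ (x z) _ h , ∧-conicalˡ (I L z) _ (∧-conicalʳ (x z) _ h)

  hyperoval∈C⊥ : ∀ H → _⊆_ Π H S → IsHyperoval Π H → InC⊥ H
  hyperoval∈C⊥ H H⊆S (_ , H∩L) = supported , λ L _ →
    trans (xorSum≡parity∘count (λ z → H z ∧ row L z))
      (trans (cong parity (count-cong (λ z → in-S (I L z) (H z) (H⊆S z)))) (even (H∩L L)))
    where
    supported : SupportedOnS H
    supported p sp with H p in hp
    ... | false = refl
    ... | true = trans (sym (H⊆S p hp)) sp
    in-S : ∀ i h {s} → (h ≡ true → s ≡ true) → h ∧ (i ∧ s) ≡ i ∧ h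
    in-S i false _ = sym (∧-zeroʳ i)
    in-S i true s≡ rewrite s≡ refl = refl
    even : ∀ {m} → (m ≡ 0) ⊎ (m ≡ 2) → parity m ≡ false
    even (inj₁ refl) = refl
    even (inj₂ refl) = refl

  minDist-even : InC⊥ S → ∀ {d} → IsMinDist InC d → 2 ∣ d
  minDist-even S⊥ ((c , c∈C , _ , |c|) , _) = parity≡false⇒2∣ _ (trans (cong parity (sym |c|)) (InC-even S⊥ c c∈C))

  minDist≤meet : ∀ {d} → IsMinDist InC d → ∀ L → IsBlock L → d ≤ meet Π L S
  minDist≤meet (_ , minimal) L b = minimal (row L) (row∈C L b) (row-nonzero L b)

  module _ .{{_ : NonZero q}} where

    block-through-point : ∀ p → S p ≡ true → ∃ IsBlock
    block-through-point p sp with count>0⇒witness (λ L → I L p) (subst (0 <_) (sym (lines-through-point Π p)) (s≤s z≤n))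
    ... | L , ip = L , block-through L p ip sp

    InC⊥-weight≥q+2 : ∀ x → InC⊥ x → ∀ p → x p ≡ true → q + 2 ≤ count x
    InC⊥-weight≥q+2 x x∈C⊥ p xp = subst₂ _≤_ (+-comm 2 q) (sym (count-remove x p xp))
      (s≤s (subst (_≤ count (x ∖ p)) (lines-through-point Π p)
        (lines-through≤ Π p (x ∖ p) λ L ip →
          let (z , z≢p , xz , iz) = another-on-line x x∈C⊥ p xp L ip
          in z , z≢p , ∖-true x xz z≢p , iz)))

    InC⊥-collinear-triple : ∀ x → InC⊥ x → ∀ L₀ p a b → x p ≡ true → x a ≡ true → x b ≡ true →
      a ≢ p → b ≢ p → a ≢ b → I L₀ p ≡ true → I L₀ a ≡ true → I L₀ b ≡ true → q + 3 ≤ count x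
    InC⊥-collinear-triple x x∈C⊥ L₀ p a b xp xa xb a≢p b≢p a≢b i₀p i₀a i₀b =
      subst₂ _≤_ (+-comm 3 q) (sym (trans (count-remove x p xp) (cong suc (count-remove (x ∖ p) b (∖-true x xb b≢p)))))
        (s≤s (s≤s (subst (_≤ count ((x ∖ p) ∖ b)) (lines-through-point Π p) (lines-through≤ Π p ((x ∖ p) ∖ b) pick))))
      where
      pick : ∀ L → I L p ≡ true → ∃ λ z → (z ≢ p) × (((x ∖ p) ∖ b) z ≡ true) × (I L z ≡ true)
      pick L ip with L ≟ L₀
      ... | yes refl = a , a≢p , ∖-true (x ∖ p) (∖-true x xa a≢p) a≢b , i₀a
      ... | no L≢L₀ = let (z , z≢p , xz , iz) = another-on-line x x∈C⊥ p xp L ip in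
            z , z≢p , ∖-true (x ∖ p) (∖-true x xz z≢p) (λ { refl → L≢L₀ (same-line Π p b L L₀ b≢p ip iz i₀p i₀b) }) , iz

    InC⊥-weight-q+2⇒hyperoval : ∀ x → InC⊥ x → count x ≡ q + 2 → IsHyperoval Π x
    InC⊥-weight-q+2⇒hyperoval x x∈C⊥ |x| = |x| , λ L →
      parity≡false-≤2 (meet Π L x) (≤2 L) (InC⊥-line-meet x x∈C⊥ L)
      where
      ≤2 : ∀ L → meet Π L x ≤ 2
      ≤2 L with meet Π L x ≤? 2
      ... | yes le = le
      ... | no gt with three-witnesses (λ z → I L z ∧ x z) (≰⇒> gt)
      ... | p , a , b , hp , ha , hb , a≢p , b≢p , a≢b
        with +-cancelˡ-≤ q 3 2 (subst (q + 3 ≤_) |x|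
               (InC⊥-collinear-triple x x∈C⊥ L p a b (∧-conicalʳ _ _ hp) (∧-conicalʳ _ _ ha) (∧-conicalʳ _ _ hb)
                  a≢p b≢p a≢b (∧-conicalˡ _ _ hp) (∧-conicalˡ _ _ ha) (∧-conicalˡ _ _ hb)))
      ... | s≤s (s≤s ())

    minDist⊥-hyperoval : ∀ {d⊥} → IsMinDist InC⊥ d⊥ → ContainsHyperoval → d⊥ ≡ q + 2
    minDist⊥-hyperoval ((c , c∈C⊥ , c≢0 , |c|) , minimal) (H , H⊆S , H-hyperoval@(|H| , _)) = ≤-antisym
      (subst (_ ≤_) |H| (minimal H (hyperoval∈C⊥ H H⊆S H-hyperoval) H≢0))
      (subst (q + 2 ≤_) |c| (let (p , cp) = ¬none⇒witness c c≢0 in InC⊥-weight≥q+2 c c∈C⊥ p cp))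
      where
      H≢0 : Nonzero H
      H≢0 none with trans (+-comm 2 q) (trans (sym |H|) (count-none H none))
      ... | ()

    minDist⊥-no-hyperoval : parity q ≡ false → ∀ {d⊥} → IsMinDist InC⊥ d⊥ → ¬ ContainsHyperoval → q + 4 ≤ d⊥
    minDist⊥-no-hyperoval q-even ((c , c∈C⊥ , c≢0 , |c|) , _) no-hyperoval =
      subst₂ _≤_ (+-comm 4 q) |c| (≤∧≢⇒< (≤∧≢⇒< ≥q+2 ≢q+2) ≢q+3)
      where
      ≥q+2 : 2 + q ≤ count c
      ≥q+2 = subst (_≤ count c) (+-comm q 2) (let (p , cp) = ¬none⇒witness c c≢0 in InC⊥-weight≥q+2 c c∈C⊥ p cp)
      ≢q+2 : 2 + q ≢ count c
      ≢q+2 e = no-hyperoval (c , supported⇒⊆S c (proj₁ c∈C⊥) , InC⊥-weight-q+2⇒hyperoval c c∈C⊥ (trans (sym e) (+-comm 2 q)))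
      S∈C′ : InC S
      S∈C′ = S∈C λ p → trans (cong parity (lines-through-point Π p)) (cong not q-even)
      ≢q+3 : 3 + q ≢ count c
      ≢q+3 e = contradiction (trans (cong (λ b → not (not (not b))) (sym q-even)) (trans (cong parity e) (InC⊥-even S∈C′ c c∈C⊥))) λ ()

-- Counting binary words

Word : ℕ → Set
Word n = Vec Bool n

countWords : ∀ N → (Word N → Bool) → ℕ
countWords zero P = if P [] then 1 else 0
countWords (suc N) P = countWords N (λ v → P (false ∷ v)) + countWords N (λ v → P (true ∷ v))

search : ∀ N (P : Word N → Bool) → (∃ λ v → P v ≡ true) ⊎ (∀ v → P v ≡ false)
search zero P with P [] in e
... | true = inj₁ ([] , e)
... | false = inj₂ (λ { [] → e })
search (suc N) P with search N (λ v → P (false ∷ v)) | search N (λ v → P (true ∷ v))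
... | inj₁ (v , e) | _ = inj₁ (false ∷ v , e)
... | inj₂ _ | inj₁ (v , e) = inj₁ (true ∷ v , e)
... | inj₂ h₀ | inj₂ h₁ = inj₂ λ { (false ∷ v) → h₀ v ; (true ∷ v) → h₁ v }

countWords-cong : ∀ N {P Q : Word N → Bool} → (∀ v → P v ≡ Q v) → countWords N P ≡ countWords N Q
countWords-cong zero e = cong (λ b → if b then 1 else 0) (e [])
countWords-cong (suc N) e = cong₂ _+_ (countWords-cong N (λ v → e (false ∷ v))) (countWords-cong N (λ v → e (true ∷ v)))

countWords-none : ∀ N (P : Word N → Bool) → (∀ v → P v ≡ false) → countWords N P ≡ 0
countWords-none zero P e rewrite e [] = refl
countWords-none (suc N) P e = cong₂ _+_ (countWords-none N _ (λ v → e (false ∷ v))) (countWords-none N _ (λ v → e (true ∷ v)))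

countWords-all : ∀ N (P : Word N → Bool) → (∀ v → P v ≡ true) → countWords N P ≡ 2 ^ N
countWords-all zero P e rewrite e [] = refl
countWords-all (suc N) P e = trans (cong₂ _+_ (countWords-all N _ (λ v → e (false ∷ v))) (countWords-all N _ (λ v → e (true ∷ v))))
  (cong (2 ^ N +_) (sym (+-identityʳ (2 ^ N))))

countWords-split : ∀ N (P Q : Word N → Bool) →
  countWords N P ≡ countWords N (λ v → P v ∧ Q v) + countWords N (λ v → P v ∧ not (Q v))
countWords-split zero P Q with P [] | Q []
... | false | _ = refl
... | true | true = refl
... | true | false = refl
countWords-split (suc N) P Q = trans (cong₂ _+_ (countWords-split N (λ v → P (false ∷ v)) (λ v → Q (false ∷ v)))
  (countWords-split N (λ v → P (true ∷ v)) (λ v → Q (true ∷ v))))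
  (+-interchange (countWords N (λ v → P (false ∷ v) ∧ Q (false ∷ v))) (countWords N (λ v → P (false ∷ v) ∧ not (Q (false ∷ v))))
                 (countWords N (λ v → P (true ∷ v) ∧ Q (true ∷ v))) (countWords N (λ v → P (true ∷ v) ∧ not (Q (true ∷ v)))))

countWords-mono : ∀ N (P Q : Word N → Bool) → (∀ v → P v ≡ true → Q v ≡ true) → countWords N P ≤ countWords N Q
countWords-mono zero P Q h with P [] in e | Q [] in e′
... | false | _ = z≤n
... | true | true = ≤-refl
... | true | false with trans (sym e′) (h [] e)
... | ()
countWords-mono (suc N) P Q h = +-mono-≤ (countWords-mono N _ _ (λ v → h (false ∷ v))) (countWords-mono N _ _ (λ v → h (true ∷ v)))

witness⇒countWords>0 : ∀ N (P : Word N → Bool) v → P v ≡ true → 0 < countWords N P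
witness⇒countWords>0 zero P [] e rewrite e = ≤-refl
witness⇒countWords>0 (suc N) P (false ∷ v) e = ≤-trans (witness⇒countWords>0 N _ v e) (m≤m+n _ _)
witness⇒countWords>0 (suc N) P (true ∷ v) e = ≤-trans (witness⇒countWords>0 N _ v e) (m≤n+m _ _)

-- Words starting with false go into the image of F on such words, the others into its complement.
countWords-injection : ∀ N M (P : Word N → Bool) (Q : Word M → Bool) (F : Word N → Word M) →
  (∀ v → P v ≡ true → Q (F v) ≡ true) →
  (∀ v w → P v ≡ true → P w ≡ true → F v ≡ F w → v ≡ w) → countWords N P ≤ countWords M Q
countWords-injection zero M P Q F into inj with P [] in e
... | false = z≤n
... | true = witness⇒countWords>0 M Q (F []) (into [] e)
countWords-injection (suc N) M P Q F into inj =
  ≤-trans (+-mono-≤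
    (countWords-injection N M (λ v → P (false ∷ v)) (λ w → Q w ∧ image w) (λ v → F (false ∷ v))
       (λ v pv → cong₂ _∧_ (into _ pv) (image-false v pv)) (λ v w pv pw e → ∷-injectiveʳ (inj _ _ pv pw e)))
    (countWords-injection N M (λ v → P (true ∷ v)) (λ w → Q w ∧ not (image w)) (λ v → F (true ∷ v))
       (λ v pv → cong₂ _∧_ (into _ pv) (cong not (image-true v pv))) (λ v w pv pw e → ∷-injectiveʳ (inj _ _ pv pw e))))
    (≤-reflexive (sym (countWords-split M Q image)))
  where
  ∷-injectiveʳ : ∀ {b} {v w : Word N} → _≡_ {A = Word (suc N)} (b ∷ v) (b ∷ w) → v ≡ w
  ∷-injectiveʳ refl = refl
  image : Word M → Bool
  image w with search N (λ v → P (false ∷ v) ∧ does (≡-dec Bool._≟_ (F (false ∷ v)) w))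
  ... | inj₁ _ = true
  ... | inj₂ _ = false
  image-false : ∀ v → P (false ∷ v) ≡ true → image (F (false ∷ v)) ≡ true
  image-false v pv with search N (λ u → P (false ∷ u) ∧ does (≡-dec Bool._≟_ (F (false ∷ u)) (F (false ∷ v))))
  ... | inj₁ _ = refl
  ... | inj₂ none with trans (sym (none v)) (cong₂ _∧_ pv (dec-true (≡-dec Bool._≟_ (F (false ∷ v)) (F (false ∷ v))) refl))
  ... | ()
  image-true : ∀ v → P (true ∷ v) ≡ true → image (F (true ∷ v)) ≡ false
  image-true v pv with search N (λ u → P (false ∷ u) ∧ does (≡-dec Bool._≟_ (F (false ∷ u)) (F (true ∷ v))))
  ... | inj₂ _ = refl
  ... | inj₁ (u , e) with inj _ _ (∧-conicalˡ _ _ e) pv (does-true⇒ (≡-dec Bool._≟_ _ _) (∧-conicalʳ _ _ e))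
  ... | ()

countWords-product : ∀ a b (P : Word a → Bool) (Q : Word b → Bool) →
  countWords (a + b) (λ v → P (take a v) ∧ Q (drop a v)) ≡ countWords a P * countWords b Q
countWords-product zero b P Q with P []
... | true = sym (+-identityʳ (countWords b Q))
... | false = countWords-none b (λ _ → false) (λ _ → refl)
countWords-product (suc a) b P Q =
  trans (cong₂ _+_ (countWords-product a b (λ u → P (false ∷ u)) Q) (countWords-product a b (λ u → P (true ∷ u)) Q))
    (sym (*-distribʳ-+ (countWords b Q) (countWords a (λ u → P (false ∷ u))) (countWords a (λ u → P (true ∷ u)))))

argmin : ∀ N (P : Word N → Bool) (w : Word N → ℕ) v₀ → P v₀ ≡ true →
  ∃ λ v → (P v ≡ true) × (∀ u → P u ≡ true → w v ≤ w u)
argmin zero P w [] p₀ = [] , p₀ , λ { [] _ → ≤-refl }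
argmin (suc N) P w v₀ p₀ with search N (λ v → P (false ∷ v)) | search N (λ v → P (true ∷ v))
... | inj₁ (a , pa) | inj₁ (b , pb) with argmin N _ (λ v → w (false ∷ v)) a pa | argmin N _ (λ v → w (true ∷ v)) b pb
... | v , pv , min₀ | v′ , pv′ , min₁ with w (false ∷ v) ≤? w (true ∷ v′)
...   | yes le = false ∷ v , pv , λ { (false ∷ u) pu → min₀ u pu ; (true ∷ u) pu → ≤-trans le (min₁ u pu) }
...   | no gt = true ∷ v′ , pv′ , λ { (false ∷ u) pu → ≤-trans (<⇒≤ (≰⇒> gt)) (min₀ u pu) ; (true ∷ u) pu → min₁ u pu }
argmin (suc N) P w v₀ p₀ | inj₁ (a , pa) | inj₂ h₁ with argmin N _ (λ v → w (false ∷ v)) a pa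
... | v , pv , min₀ = false ∷ v , pv , λ { (false ∷ u) pu → min₀ u pu ; (true ∷ u) pu → contradiction (trans (sym (h₁ u)) pu) λ () }
argmin (suc N) P w v₀ p₀ | inj₂ h₀ | inj₁ (b , pb) with argmin N _ (λ v → w (true ∷ v)) b pb
... | v , pv , min₁ = true ∷ v , pv , λ { (true ∷ u) pu → min₁ u pu ; (false ∷ u) pu → contradiction (trans (sym (h₀ u)) pu) λ () }
argmin (suc N) P w (false ∷ v₀) p₀ | inj₂ h₀ | inj₂ h₁ with trans (sym (h₀ v₀)) p₀
... | ()
argmin (suc N) P w (true ∷ v₀) p₀ | inj₂ h₀ | inj₂ h₁ with trans (sym (h₁ v₀)) p₀
... | ()

lookup-ext : ∀ {N} (u v : Word N) → (∀ i → lookup u i ≡ lookup v i) → u ≡ v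
lookup-ext u v e = trans (sym (tabulate∘lookup u)) (trans (tabulate-cong e) (tabulate∘lookup v))

wordWeight : ∀ {N} → Word N → ℕ
wordWeight v = count (lookup v)

within : ∀ {N} → (Fin N → Bool) → Word N → Bool
within {zero} X [] = true
within {suc N} X (b ∷ v) = (X zero ∨ not b) ∧ within (λ i → X (suc i)) v

within-sound : ∀ {N} (X : Fin N → Bool) v → within X v ≡ true → ∀ p → X p ≡ false → lookup v p ≡ false
within-sound X (b ∷ v) e zero xp rewrite xp with b
... | false = refl
within-sound X (true ∷ v) () zero xp | true
within-sound X (b ∷ v) e (suc p) xp = within-sound (λ i → X (suc i)) v (∧-conicalʳ _ _ e) p xp

within-complete : ∀ {N} (X : Fin N → Bool) v → (∀ p → X p ≡ false → lookup v p ≡ false) → within X v ≡ true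
within-complete X [] h = refl
within-complete X (b ∷ v) h = cong₂ _∧_ (head (X zero) refl) (within-complete (λ i → X (suc i)) v (λ p → h (suc p)))
  where
  head : ∀ x → X zero ≡ x → x ∨ not b ≡ true
  head true _ = refl
  head false e = cong not (h zero e)

countWords-within : ∀ N (X : Fin N → Bool) → countWords N (within X) ≡ 2 ^ count X
countWords-within zero X = refl
countWords-within (suc N) X with X zero
... | true = trans (cong₂ _+_ (countWords-within N _) (countWords-within N _))
               (cong (2 ^ count (λ i → X (suc i)) +_) (sym (+-identityʳ _)))
... | false = trans (cong₂ _+_ (countWords-within N _) (countWords-none N (λ _ → false) (λ _ → refl))) (+-identityʳ _)

countWords-wordWeight : ∀ N (X : Fin N → Bool) i → countWords N (λ v → within X v ∧ (wordWeight v ≡ᵇ i)) ≡ count X C i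
countWords-wordWeight zero X zero = refl
countWords-wordWeight zero X (suc i) = refl
countWords-wordWeight (suc N) X i with X zero
countWords-wordWeight (suc N) X zero | true =
  trans (cong₂ _+_ (countWords-wordWeight N X′ zero) (countWords-none N _ (λ v → ∧-zeroʳ (within X′ v))))
    (trans (+-identityʳ _) (trans (nC0≡1 (count X′)) (sym (nC0≡1 (suc (count X′))))))
  where X′ = λ j → X (suc j)
        nC0≡1 : ∀ n → n C 0 ≡ 1
        nC0≡1 n = trans (nCk≡nC[n∸k] {0} {n} z≤n) (nCn≡1 n)
countWords-wordWeight (suc N) X (suc i) | true =
  trans (cong₂ _+_ (countWords-wordWeight N X′ (suc i)) (countWords-wordWeight N X′ i))
    (trans (+-comm (count X′ C suc i) (count X′ C i)) (nCk+nC[k+1]≡[n+1]C[k+1] (count X′) i))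
  where X′ = λ j → X (suc j)
countWords-wordWeight (suc N) X i | false =
  trans (cong₂ _+_ (countWords-wordWeight N _ i) (countWords-none N (λ _ → false) (λ _ → refl))) (+-identityʳ _)

sumUpTo-suc : ∀ e f → sumUpTo (suc e) f ≡ sumUpTo e f + f (suc e)
sumUpTo-suc e f = begin
    sum (map f (upTo (suc (suc e))))
  ≡⟨ cong sum (map-upTo f (suc (suc e))) ⟩
    sum (applyUpTo f (suc (suc e)))
  ≡⟨ cong sum (sym (applyUpTo-∷ʳ f (suc e))) ⟩
    sum (applyUpTo f (suc e) ++ (f (suc e) ∷ []))
  ≡⟨ sum-++ (applyUpTo f (suc e)) (f (suc e) ∷ []) ⟩
    sum (applyUpTo f (suc e)) + (f (suc e) + 0)
  ≡⟨ cong₂ _+_ (cong sum (sym (map-upTo f (suc e)))) (+-identityʳ _) ⟩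
    sum (map f (upTo (suc e))) + f (suc e) ∎
  where open ≡-Reasoning

countWords-ball : ∀ N (X : Fin N → Bool) e →
  countWords N (λ v → within X v ∧ (wordWeight v ≤ᵇ e)) ≡ sumUpTo e (λ i → count X C i)
countWords-ball N X zero = trans (countWords-cong N (λ v → cong (within X v ∧_) (≤ᵇ0 (wordWeight v))))
  (trans (countWords-wordWeight N X 0) (sym (+-identityʳ _)))
  where
  ≤ᵇ0 : ∀ m → (m ≤ᵇ 0) ≡ (m ≡ᵇ 0)
  ≤ᵇ0 zero = refl
  ≤ᵇ0 (suc m) = refl
countWords-ball N X (suc e) = begin
    countWords N (λ v → within X v ∧ (wordWeight v ≤ᵇ suc e))
  ≡⟨ countWords-split N _ (λ v → wordWeight v ≤ᵇ e) ⟩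
    countWords N (λ v → (within X v ∧ (wordWeight v ≤ᵇ suc e)) ∧ (wordWeight v ≤ᵇ e)) +
    countWords N (λ v → (within X v ∧ (wordWeight v ≤ᵇ suc e)) ∧ not (wordWeight v ≤ᵇ e))
  ≡⟨ cong₂ _+_ (countWords-cong N (λ v → trans (∧-assoc (within X v) _ _) (cong (within X v ∧_) (≤ᵇ-inner (wordWeight v) e))))
               (countWords-cong N (λ v → trans (∧-assoc (within X v) _ _) (cong (within X v ∧_) (≤ᵇ-boundary (wordWeight v) e)))) ⟩
    countWords N (λ v → within X v ∧ (wordWeight v ≤ᵇ e)) + countWords N (λ v → within X v ∧ (wordWeight v ≡ᵇ suc e))
  ≡⟨ cong₂ _+_ (countWords-ball N X e) (countWords-wordWeight N X (suc e)) ⟩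
    sumUpTo e (λ i → count X C i) + count X C suc e
  ≡⟨ sym (sumUpTo-suc e (λ i → count X C i)) ⟩
    sumUpTo (suc e) (λ i → count X C i) ∎
  where
  open ≡-Reasoning
  ≤ᵇ-inner : ∀ m e → (m ≤ᵇ suc e) ∧ (m ≤ᵇ e) ≡ (m ≤ᵇ e)
  ≤ᵇ-inner zero e = refl
  ≤ᵇ-inner (suc zero) zero = refl
  ≤ᵇ-inner (suc (suc m)) zero = refl
  ≤ᵇ-inner (suc zero) (suc e) = refl
  ≤ᵇ-inner (suc (suc m)) (suc e) = ≤ᵇ-inner (suc m) e
  ≤ᵇ-boundary : ∀ m e → (m ≤ᵇ suc e) ∧ not (m ≤ᵇ e) ≡ (m ≡ᵇ suc e)
  ≤ᵇ-boundary zero e = refl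
  ≤ᵇ-boundary (suc zero) zero = refl
  ≤ᵇ-boundary (suc (suc m)) zero = refl
  ≤ᵇ-boundary (suc zero) (suc e) = refl
  ≤ᵇ-boundary (suc (suc m)) (suc e) = ≤ᵇ-boundary (suc m) e

_⊕_ : ∀ {N} → Word N → Word N → Word N
_⊕_ = zipWith _xor_

-- Translating by a fixed word w with K w and g w maps the words of K with g = true
-- injectively into those with g = false.
countWords-halving : ∀ N (K g : Word N → Bool) →
  (∀ u v → K u ≡ true → K v ≡ true → K (u ⊕ v) ≡ true) → (∀ u v → g (u ⊕ v) ≡ g u xor g v) →
  countWords N K ≤ 2 * countWords N (λ v → K v ∧ not (g v))
countWords-halving N K g closed linear with search N (λ v → K v ∧ g v)
... | inj₂ none = ≤-trans (≤-reflexive (trans (countWords-split N K g) (cong (_+ rest) (countWords-none N _ none))))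
                    (m≤m+n rest (rest + 0))
  where rest = countWords N (λ v → K v ∧ not (g v))
... | inj₁ (w , hw) = ≤-trans (≤-reflexive (countWords-split N K g))
      (≤-trans (+-monoˡ-≤ rest (countWords-injection N N (λ v → K v ∧ g v) (λ v → K v ∧ not (g v)) (w ⊕_) into inj))
        (≤-reflexive (cong (rest +_) (sym (+-identityʳ rest)))))
  where
  rest = countWords N (λ v → K v ∧ not (g v))
  into : ∀ v → K v ∧ g v ≡ true → K (w ⊕ v) ∧ not (g (w ⊕ v)) ≡ true
  into v e rewrite closed w v (∧-conicalˡ _ _ hw) (∧-conicalˡ _ _ e) | linear w v
                 | ∧-conicalʳ (K w) _ hw | ∧-conicalʳ (K v) _ e = refl
  inj : ∀ v v′ → K v ∧ g v ≡ true → K v′ ∧ g v′ ≡ true → w ⊕ v ≡ w ⊕ v′ → v ≡ v′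
  inj v v′ _ _ e = lookup-ext v v′ λ p → xor-cancelˡ (lookup w p)
    (trans (sym (lookup-zipWith _xor_ p w v)) (trans (cong (λ x → lookup x p) e) (lookup-zipWith _xor_ p w v′)))

module _ {q : ℕ} (Π : ProjectivePlane q) (S : PtSet Π) where
  open ProjectivePlane Π
  open ArcDesign Π S

  combination : ∀ {r} → (Fin r → Fin nLines) → (Fin r → Bool) → Vector
  combination rs T p = xorSum (λ i → T i ∧ row (rs i) p)

  combination-cong : ∀ {r} (rs : Fin r → Fin nLines) {T T′} → (∀ i → T i ≡ T′ i) →
    ∀ p → combination rs T p ≡ combination rs T′ p
  combination-cong rs e p = xorSum-cong (λ i → cong (_∧ _) (e i))

  combination-xor : ∀ {r} (rs : Fin r → Fin nLines) T T′ p →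
    combination rs (λ i → T i xor T′ i) p ≡ combination rs T p xor combination rs T′ p
  combination-xor rs T T′ p = trans (xorSum-cong (λ i → ∧-distribʳ-xor (row (rs i) p) (T i) (T′ i)))
    (xorSum-xor (λ i → T i ∧ row (rs i) p) (λ i → T′ i ∧ row (rs i) p))

  InSpan : ∀ {r} → (Fin r → Fin nLines) → Fin nLines → Set
  InSpan {r} rs L = Σ (Fin r → Bool) λ T → ∀ p → row L p ≡ combination rs T p

  Independent : ∀ {r} → (Fin r → Fin nLines) → Set
  Independent {r} rs = ∀ (T : Fin r → Bool) → (∀ p → combination rs T p ≡ false) → ∀ i → T i ≡ false

  inSpan? : ∀ {r} (rs : Fin r → Fin nLines) L → Dec (InSpan rs L)
  inSpan? {r} rs L with search r (λ t → does (all? (λ p → row L p Bool.≟ combination rs (lookup t) p)))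
  ... | inj₁ (t , e) = yes (lookup t , does-true⇒ (all? _) e)
  ... | inj₂ none = no λ (T , e) → contradiction (trans (sym (none (tabulate T)))
          (dec-true (all? _) (λ p → trans (e p) (combination-cong rs (λ i → sym (lookup∘tabulate T i)) p)))) λ ()

  independent-extend : ∀ {r} (rs : Fin r → Fin nLines) L → ¬ InSpan rs L → Independent rs →
    Independent (L ∷ᶠ rs)
  independent-extend rs L L∉span independent T trivial = all-false
    where
    head-false : T zero ≡ false
    head-false with T zero in e
    ... | false = refl
    ... | true = ⊥-elim (L∉span ((λ i → T (suc i)) , λ p → xor≡false⇒≡ (trivial p)))
    all-false : ∀ i → T i ≡ false
    all-false zero = head-false
    all-false (suc i) = independent (λ i → T (suc i))
      (λ p → trans (cong (λ b → (b ∧ row L p) xor combination rs (λ i → T (suc i)) p) (sym head-false)) (trivial p)) i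

  record Basis (Ls : List (Fin nLines)) : Set where
    field
      size : ℕ
      lines : Fin size → Fin nLines
      blocks : ∀ i → IsBlock (lines i)
      independent : Independent lines
      spans : ∀ L → L ∈ Ls → IsBlock L → InSpan lines L

  basis : ∀ Ls → Basis Ls
  basis [] = record { size = 0 ; lines = λ () ; blocks = λ () ; independent = λ _ _ () ; spans = λ _ () }
  basis (L ∷ Ls) with basis Ls
  ... | B with isBlock? Π S L in bl
  ... | false = record { Basis B ; spans = λ
          { L′ (here refl) b → contradiction (trans (sym (isBlock?-complete Π S L′ b)) bl) λ ()
          ; L′ (there L′∈) b → spans L′ L′∈ b } }
    where open Basis B
  ... | true with inSpan? (Basis.lines B) L
  ... | yes L∈span = record { Basis B ; spans = λ
          { L′ (here refl) _ → L∈span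
          ; L′ (there L′∈) b → spans L′ L′∈ b } }
    where open Basis B
  ... | no L∉span = record
          { size = suc size
          ; lines = L ∷ᶠ lines
          ; blocks = λ { zero → isBlock?-sound Π S L bl ; (suc i) → blocks i }
          ; independent = independent-extend lines L L∉span independent
          ; spans = λ
              { L′ (here refl) _ → (true ∷ᶠ λ _ → false) , λ p →
                  sym (trans (cong (row L p xor_) (xorSum-none {size} (λ _ → false) (λ _ → refl))) (xor-identityʳ (row L p)))
              ; L′ (there L′∈) b → let (T , e) = spans L′ L′∈ b in (false ∷ᶠ T) , e } }
    where open Basis B

  rank-exists : ∃ IsRank₂
  rank-exists = let open Basis (basis (allFin nLines)) in
    size , lines , blocks , independent , λ L → spans L (∈-allFin L)

  combination∈C : ∀ {r} (rs : Fin r → Fin nLines) → (∀ i → IsBlock (rs i)) → ∀ T → InC (combination rs T)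
  combination∈C rs blocks T = coefficient , coefficient-block , λ p → begin
      xorSum (λ i → T i ∧ row (rs i) p)
    ≡⟨ xorSum-cong (λ i → cong (T i ∧_) (sym (xorSum-select (rs i) (λ L → row L p)))) ⟩
      xorSum (λ i → T i ∧ xorSum (λ L → does (L ≟ rs i) ∧ row L p))
    ≡⟨ xorSum-combination T (λ i L → does (L ≟ rs i)) (λ L → row L p) ⟩
      xorSum (λ L → coefficient L ∧ row L p) ∎
    where
    open ≡-Reasoning
    coefficient : Fin nLines → Bool
    coefficient L = xorSum (λ i → T i ∧ does (L ≟ rs i))
    coefficient-block : ∀ L → coefficient L ≡ true → IsBlock L
    coefficient-block L e = let (i , h) = xorSum≡true⇒witness _ e in
      subst IsBlock (sym (does-true⇒ (L ≟ rs i) (∧-conicalʳ (T i) _ h))) (blocks i)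

  InC⇒combination : ∀ {r} (rs : Fin r → Fin nLines) → (∀ L → IsBlock L → InSpan rs L) →
    ∀ c → InC c → Σ (Fin r → Bool) λ T → ∀ p → c p ≡ combination rs T p
  InC⇒combination {r} rs spans c (T₀ , blocks , c≡) = (λ i → xorSum (λ L → T₀ L ∧ U L i)) , λ p → begin
      c p
    ≡⟨ c≡ p ⟩
      xorSum (λ L → T₀ L ∧ row L p)
    ≡⟨ xorSum-cong (λ L → proj₂ (expansion L) p) ⟩
      xorSum (λ L → T₀ L ∧ combination rs (U L) p)
    ≡⟨ xorSum-combination T₀ U (λ i → row (rs i) p) ⟩
      combination rs (λ i → xorSum (λ L → T₀ L ∧ U L i)) p ∎
    where
    open ≡-Reasoning
    expansion : ∀ L → Σ (Fin r → Bool) λ U → ∀ p → T₀ L ∧ row L p ≡ T₀ L ∧ combination rs U p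
    expansion L with T₀ L in e
    ... | true = spans L (blocks L e)
    ... | false = (λ _ → false) , λ _ → refl
    U : Fin nLines → Fin r → Bool
    U L = proj₁ (expansion L)

  orthogonal-to-span : ∀ {r} (rs : Fin r → Fin nLines) → (∀ L → IsBlock L → InSpan rs L) →
    ∀ x → (∀ i → x · row (rs i) ≡ false) → ∀ L → IsBlock L → x · row L ≡ false
  orthogonal-to-span rs spans x x⊥ L b = let (U , e) = spans L b in
    trans (xorSum-cong (λ p → cong (x p ∧_) (e p)))
      (trans (·-combination x U (λ i → row (rs i)))
        (xorSum-none _ (λ i → trans (cong (U i ∧_) (x⊥ i)) (∧-zeroʳ (U i)))))

  nonzero? : ∀ x → Dec (Nonzero x)
  nonzero? x = ¬? (all? (λ p → x p Bool.≟ false))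

  nonzero-cong : ∀ {x y} → (∀ p → x p ≡ y p) → Nonzero x → Nonzero y
  nonzero-cong e x≢0 y≡0 = x≢0 (λ p → trans (e p) (y≡0 p))

  combination-tabulate : ∀ {r} (rs : Fin r → Fin nLines) T p → combination rs T p ≡ combination rs (lookup (tabulate T)) p
  combination-tabulate rs T = combination-cong rs (λ i → sym (lookup∘tabulate T i))

  minDist-exists : ∀ {r} (rs : Fin r → Fin nLines) → (∀ i → IsBlock (rs i)) → (∀ L → IsBlock L → InSpan rs L) →
    ∀ L → IsBlock L → ∃ (IsMinDist InC)
  minDist-exists {r} rs blocks spans L b with spans L b
  ... | T₀ , row≡ with argmin r (λ t → does (nonzero? (combination rs (lookup t)))) (λ t → count (combination rs (lookup t)))
                         (tabulate T₀) (dec-true (nonzero? _) (nonzero-cong (λ p → trans (row≡ p) (combination-tabulate rs T₀ p)) (row-nonzero Π S L b)))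
  ... | t , t≢0 , minimal =
    _ , (combination rs (lookup t) , combination∈C rs blocks (lookup t) , does-true⇒ (nonzero? _) t≢0 , refl) ,
    λ c c∈C c≢0 → let (T , c≡) = InC⇒combination rs spans c c∈C
                      c≡′ p = trans (c≡ p) (combination-tabulate rs T p) in
      ≤-trans (minimal (tabulate T) (dec-true (nonzero? _) (nonzero-cong c≡′ c≢0))) (≤-reflexive (sym (count-cong c≡′)))

  InC⊥? : ∀ x → Dec (InC⊥ x)
  InC⊥? x = all? (λ p → (S p Bool.≟ false) →-dec (x p Bool.≟ false))
       ×-dec all? (λ L → (0 <? meet Π L S) →-dec ((x · row L) Bool.≟ false))

  InC⊥-cong : ∀ {x y} → (∀ p → x p ≡ y p) → InC⊥ x → InC⊥ y
  InC⊥-cong e (supported , x⊥) = (λ p sp → trans (sym (e p)) (supported p sp)) ,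
    λ L b → trans (xorSum-cong (λ p → cong (_∧ row L p) (sym (e p)))) (x⊥ L b)

  nonzero-InC⊥? : ∀ x → Dec (InC⊥ x × Nonzero x)
  nonzero-InC⊥? x = InC⊥? x ×-dec nonzero? x

  minDist⊥-exists : InC⊥ S → ∀ p → S p ≡ true → ∃ (IsMinDist InC⊥)
  minDist⊥-exists S⊥ p₀ sp₀ with argmin _ (λ v → does (nonzero-InC⊥? (lookup v))) wordWeight (tabulate S)
         (dec-true (nonzero-InC⊥? _) (InC⊥-cong S≡ S⊥ , nonzero-cong S≡ (λ none → contradiction (trans (sym sp₀) (none p₀)) λ ())))
    where S≡ = λ p → sym (lookup∘tabulate S p)
  ... | v , pv , minimal = _ , (lookup v , proj₁ v∈ , proj₂ v∈ , refl) , λ c c∈C⊥ c≢0 →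
    let c≡ p = sym (lookup∘tabulate c p) in
    ≤-trans (minimal (tabulate c) (dec-true (nonzero-InC⊥? _) (InC⊥-cong c≡ c∈C⊥ , nonzero-cong c≡ c≢0)))
      (≤-reflexive (sym (count-cong c≡)))
    where
    v∈ = does-true⇒ (nonzero-InC⊥? (lookup v)) pv

-- Sphere-packing and dimension bounds

-- Deleting the coordinate p₀ keeps distinct words at distance ≥ 2t + 2 at distance ≥ 2t + 1, so the
-- radius-t balls around them in the remaining count S ∸ 1 coordinates are pairwise disjoint.
module PuncturedPacking {N} (S : Fin N → Bool) (p₀ : Fin N) (p₀∈S : S p₀ ≡ true)
  {a} (P : Word a → Bool) (enc : Word a → Fin N → Bool) (t : ℕ)
  (supported : ∀ u → P u ≡ true → ∀ p → S p ≡ false → enc u p ≡ false)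
  (separated : ∀ u u′ → P u ≡ true → P u′ ≡ true → count (λ p → enc u p xor enc u′ p) ≤ suc (t + t) → u ≡ u′)
  where

  S′ : Fin N → Bool
  S′ = S ∖ p₀

  Ball : Word N → Bool
  Ball y = within S′ y ∧ (wordWeight y ≤ᵇ t)

  Admissible : Word (a + N) → Set
  Admissible w = P (take a w) ∧ Ball (drop a w) ≡ true

  received : Word a → Word N → Fin N → Bool
  received u y p = (enc u p xor lookup y p) ∧ p ≠ᵇ p₀

  F : Word (a + N) → Word N
  F w = tabulate (received (take a w) (drop a w))

  F-within : ∀ w → Admissible w → within S′ (F w) ≡ true
  F-within w adm = within-complete S′ (F w) λ p s′p → trans (lookup∘tabulate _ p) (outside p s′p (p ≠ᵇ p₀) refl)
    where
    u = take a w
    y = drop a w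
    outside : ∀ p → S′ p ≡ false → ∀ b → p ≠ᵇ p₀ ≡ b → received u y p ≡ false
    outside p _ false p≡p₀ = trans (cong ((enc u p xor lookup y p) ∧_) p≡p₀) (∧-zeroʳ _)
    outside p s′p true p≢p₀ = trans (cong ((enc u p xor lookup y p) ∧_) p≢p₀) (trans (∧-identityʳ _)
      (cong₂ _xor_ (supported u (∧-conicalˡ _ _ adm) p (trans (sym (∧-identityʳ (S p))) (trans (cong (S p ∧_) (sym p≢p₀)) s′p)))
                   (within-sound S′ y (∧-conicalˡ _ _ (∧-conicalʳ (P u) _ adm)) p s′p)))

  module _ {w w′} (adm : Admissible w) (adm′ : Admissible w′) (Fw≡Fw′ : F w ≡ F w′) where
    u = take a w
    y = drop a w
    u′ = take a w′
    y′ = drop a w′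
    y-ball = ∧-conicalʳ (P u) _ adm
    y′-ball = ∧-conicalʳ (P u′) _ adm′

    received-agree : ∀ p → p ≢ p₀ → enc u p xor lookup y p ≡ enc u′ p xor lookup y′ p
    received-agree p p≢p₀ = trans (sym (unmask u y)) (trans (cong (λ v → lookup v p) Fw≡Fw′) (unmask u′ y′))
      where
      unmask : ∀ u y → lookup (tabulate (received u y)) p ≡ enc u p xor lookup y p
      unmask u y = trans (lookup∘tabulate (received u y) p) (trans (cong (_ ∧_) (≢⇒≠ᵇ p p₀ p≢p₀)) (∧-identityʳ _))

    codewords-differ-within : ∀ p → enc u p xor enc u′ p ≡ true → does (p ≟ p₀) ∨ (lookup y p ∨ lookup y′ p) ≡ true
    codewords-differ-within p h with p ≟ p₀ | lookup y p in yp | lookup y′ p in y′p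
    ... | yes _ | _ | _ = refl
    ... | no p≢p₀ | true | _ = refl
    ... | no p≢p₀ | false | true = refl
    ... | no p≢p₀ | false | false = contradiction (trans (sym h) (trans (cong (_xor enc u′ p) agree) (xor-same (enc u′ p)))) λ ()
      where
      agree : enc u p ≡ enc u′ p
      agree = trans (sym (xor-identityʳ _))
        (trans (trans (cong (enc u p xor_) (sym yp)) (trans (received-agree p p≢p₀) (cong (enc u′ p xor_) y′p))) (xor-identityʳ _))

    codewords-close : count (λ p → enc u p xor enc u′ p) ≤ suc (t + t)
    codewords-close = begin
        count (λ p → enc u p xor enc u′ p)
      ≤⟨ count-mono _ _ codewords-differ-within ⟩
        count (λ p → does (p ≟ p₀) ∨ (lookup y p ∨ lookup y′ p))
      ≤⟨ count-∨ (λ p → does (p ≟ p₀)) _ ⟩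
        count (λ p → does (p ≟ p₀)) + count (λ p → lookup y p ∨ lookup y′ p)
      ≤⟨ +-mono-≤ (≤-reflexive (count-singleton _ p₀ (dec-true (p₀ ≟ p₀) refl) (λ i → does-true⇒ (i ≟ p₀))))
                   (count-∨ (lookup y) (lookup y′)) ⟩
        1 + (wordWeight y + wordWeight y′)
      ≤⟨ s≤s (+-mono-≤ (≤ᵇ⇒≤ (wordWeight y) t (T-of (∧-conicalʳ (within S′ y) _ y-ball)))
                       (≤ᵇ⇒≤ (wordWeight y′) t (T-of (∧-conicalʳ (within S′ y′) _ y′-ball)))) ⟩
        suc (t + t) ∎
      where
      open ≤-Reasoning
      T-of : ∀ {b} → b ≡ true → T b
      T-of refl = _

    F-injective : w ≡ w′
    F-injective = trans (sym (take++drop≡id a w)) (trans (cong₂ Data.Vec._++_ u≡u′ y≡y′) (take++drop≡id a w′))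
      where
      u≡u′ : u ≡ u′
      u≡u′ = separated u u′ (∧-conicalˡ _ _ adm) (∧-conicalˡ _ _ adm′) codewords-close
      y≡y′ : y ≡ y′
      y≡y′ = lookup-ext y y′ λ p → case (p ≟ p₀)
        where
        p₀∉S′ = trans (cong (S p₀ ∧_) (≠ᵇ-irrefl p₀)) (∧-zeroʳ (S p₀))
        case : ∀ {p} → Dec (p ≡ p₀) → lookup y p ≡ lookup y′ p
        case (yes refl) = trans (within-sound S′ y (∧-conicalˡ _ _ y-ball) p₀ p₀∉S′)
                            (sym (within-sound S′ y′ (∧-conicalˡ _ _ y′-ball) p₀ p₀∉S′))
        case {p} (no p≢p₀) = xor-cancelˡ (enc u p)
          (trans (received-agree p p≢p₀) (cong (λ v → enc v p xor lookup y′ p) (sym u≡u′)))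

punctured-sphere-packing : ∀ {N} (S : Fin N → Bool) p₀ → S p₀ ≡ true →
  ∀ a (P : Word a → Bool) (enc : Word a → Fin N → Bool) t →
  (∀ u → P u ≡ true → ∀ p → S p ≡ false → enc u p ≡ false) →
  (∀ u u′ → P u ≡ true → P u′ ≡ true → count (λ p → enc u p xor enc u′ p) ≤ suc (t + t) → u ≡ u′) →
  countWords a P * sumUpTo t (λ i → (count S ∸ 1) C i) ≤ 2 ^ (count S ∸ 1)
punctured-sphere-packing {N} S p₀ p₀∈S a P enc t supported separated = begin
    countWords a P * sumUpTo t (λ i → (count S ∸ 1) C i)
  ≡⟨ cong (λ k → countWords a P * sumUpTo t (λ i → k C i)) (sym |S′|) ⟩
    countWords a P * sumUpTo t (λ i → count S′ C i)
  ≡⟨ cong (countWords a P *_) (sym (countWords-ball N S′ t)) ⟩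
    countWords a P * countWords N Ball
  ≡⟨ sym (countWords-product a N P Ball) ⟩
    countWords (a + N) (λ w → P (take a w) ∧ Ball (drop a w))
  ≤⟨ countWords-injection (a + N) N _ (within S′) F F-within (λ w w′ → F-injective) ⟩
    countWords N (within S′)
  ≡⟨ countWords-within N S′ ⟩
    2 ^ count S′
  ≡⟨ cong (2 ^_) |S′| ⟩
    2 ^ (count S ∸ 1) ∎
  where
  open ≤-Reasoning
  open PuncturedPacking S p₀ p₀∈S P enc t supported separated
  |S′| : count S′ ≡ count S ∸ 1
  |S′| = cong (_∸ 1) (sym (count-remove S p₀ p₀∈S))

·-⊕ : ∀ {N} (u v : Word N) c → lookup (u ⊕ v) · c ≡ (lookup u · c) xor (lookup v · c)
·-⊕ u v c = trans (xorSum-cong (λ p → cong (_∧ c p) (lookup-zipWith _xor_ p u v))) (·-xorˡ (lookup u) (lookup v) c)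

within-⊕ : ∀ {N} (X : Fin N → Bool) u v → within X u ≡ true → within X v ≡ true → within X (u ⊕ v) ≡ true
within-⊕ X u v xu xv = within-complete X (u ⊕ v) λ p xp →
  trans (lookup-zipWith _xor_ p u v) (cong₂ _xor_ (within-sound X u xu p xp) (within-sound X v xv p xp))

orthogonalTo : ∀ {N j} → (Fin N → Bool) → (Fin j → Fin N → Bool) → Word N → Bool
orthogonalTo {j = zero} X cs u = within X u
orthogonalTo {j = suc j} X cs u = orthogonalTo X (λ i → cs (suc i)) u ∧ not (lookup u · cs zero)

orthogonalTo-sound : ∀ {N j} (X : Fin N → Bool) (cs : Fin j → Fin N → Bool) u → orthogonalTo X cs u ≡ true →
  (within X u ≡ true) × (∀ i → lookup u · cs i ≡ false)
orthogonalTo-sound {j = zero} X cs u e = e , λ ()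
orthogonalTo-sound {j = suc j} X cs u e with orthogonalTo-sound X (λ i → cs (suc i)) u (∧-conicalˡ _ _ e)
... | within-X , ⊥-tail = within-X , λ { zero → not-true (∧-conicalʳ _ _ e) ; (suc i) → ⊥-tail i }
  where not-true : ∀ {b} → not b ≡ true → b ≡ false
        not-true {false} _ = refl

orthogonalTo-⊕ : ∀ {N j} (X : Fin N → Bool) (cs : Fin j → Fin N → Bool) u v →
  orthogonalTo X cs u ≡ true → orthogonalTo X cs v ≡ true → orthogonalTo X cs (u ⊕ v) ≡ true
orthogonalTo-⊕ {j = zero} X cs = within-⊕ X
orthogonalTo-⊕ {j = suc j} X cs u v eu ev =
  cong₂ _∧_ (orthogonalTo-⊕ X (λ i → cs (suc i)) u v (∧-conicalˡ _ _ eu) (∧-conicalˡ _ _ ev))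
    (trans (cong not (trans (·-⊕ u v (cs zero)) (cong₂ _xor_ (head u eu) (head v ev)))) refl)
  where
  head : ∀ w → orthogonalTo X cs w ≡ true → lookup w · cs zero ≡ false
  head w e = proj₂ (orthogonalTo-sound X cs w e) zero

-- Each linear condition at most halves the number of solutions.
countWords-orthogonalTo : ∀ {N j} (X : Fin N → Bool) (cs : Fin j → Fin N → Bool) →
  2 ^ count X ≤ countWords N (orthogonalTo X cs) * 2 ^ j
countWords-orthogonalTo {N} {zero} X cs = ≤-reflexive (trans (sym (countWords-within N X)) (sym (*-identityʳ _)))
countWords-orthogonalTo {N} {suc j} X cs = begin
    2 ^ count X
  ≤⟨ countWords-orthogonalTo X cs′ ⟩
    countWords N (orthogonalTo X cs′) * 2 ^ j
  ≤⟨ *-monoˡ-≤ (2 ^ j) (countWords-halving N (orthogonalTo X cs′) (λ u → lookup u · cs zero)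
        (orthogonalTo-⊕ X cs′) (λ u v → ·-⊕ u v (cs zero))) ⟩
    2 * countWords N (orthogonalTo X cs) * 2 ^ j
  ≡⟨ solve 2 (λ a b → con 2 :* a :* b := a :* (con 2 :* b)) refl (countWords N (orthogonalTo X cs)) (2 ^ j) ⟩
    countWords N (orthogonalTo X cs) * 2 ^ suc j ∎
  where
  open ≤-Reasoning
  cs′ = λ i → cs (suc i)

2^-nonZero : ∀ k → NonZero (2 ^ k)
2^-nonZero k = m^n≢0 2 k

⌊log₂⌋-2^* : ∀ r V → .{{_ : NonZero V}} → ⌊log₂ (2 ^ r * V) ⌋ ≡ r + ⌊log₂ V ⌋
⌊log₂⌋-2^* zero V = cong ⌊log₂_⌋ (+-identityʳ V)
⌊log₂⌋-2^* (suc r) V = trans (cong ⌊log₂_⌋ (*-assoc 2 (2 ^ r) V))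
  (trans (⌊log₂[2*b]⌋≡1+⌊log₂b⌋ (2 ^ r * V) {{m*n≢0 (2 ^ r) V {{2^-nonZero r}}}}) (cong suc (⌊log₂⌋-2^* r V)))

2^*≤2^⇒≤∸⌊log₂⌋ : ∀ r V M → 0 < V → 2 ^ r * V ≤ 2 ^ M → r ≤ M ∸ ⌊log₂ V ⌋
2^*≤2^⇒≤∸⌊log₂⌋ r V M 0<V le = m+n≤o⇒m≤o∸n r (begin
    r + ⌊log₂ V ⌋
  ≡⟨ sym (⌊log₂⌋-2^* r V {{>-nonZero 0<V}}) ⟩
    ⌊log₂ (2 ^ r * V) ⌋
  ≤⟨ ⌊log₂⌋-mono-≤ le ⟩
    ⌊log₂ (2 ^ M) ⌋
  ≡⟨ ⌊log₂[2^n]⌋≡n M ⟩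
    M ∎)
  where open ≤-Reasoning

2*≤2^⇒1+⌈log₂⌉≤ : ∀ r V → 0 < V → 2 * V ≤ 2 ^ r → 1 + ⌈log₂ V ⌉ ≤ r
2*≤2^⇒1+⌈log₂⌉≤ zero (suc V) _ le with ≤-trans (≤-reflexive (cong suc (sym (+-suc V (V + 0))))) le
... | s≤s ()
2*≤2^⇒1+⌈log₂⌉≤ (suc r) V _ le =
  s≤s (≤-trans (⌈log₂⌉-mono-≤ {V} {2 ^ r} (*-cancelˡ-≤ {V} {2 ^ r} 2 le)) (≤-reflexive (⌈log₂2^n⌉≡n r)))

2*≤2^-from-bounds : ∀ n r K V → 1 ≤ n → 2 ^ n ≤ K * 2 ^ r → K * V ≤ 2 ^ (n ∸ 1) → 2 * V ≤ 2 ^ r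
2*≤2^-from-bounds (suc n) r K V _ h₁ h₂ = *-cancelˡ-≤ (2 ^ n) {{2^-nonZero n}} (begin
    2 ^ n * (2 * V)
  ≡⟨ solve 2 (λ a v → a :* (con 2 :* v) := con 2 :* a :* v) refl (2 ^ n) V ⟩
    2 ^ suc n * V
  ≤⟨ *-monoˡ-≤ V h₁ ⟩
    K * 2 ^ r * V
  ≡⟨ solve 3 (λ k a v → k :* a :* v := k :* v :* a) refl K (2 ^ r) V ⟩
    K * V * 2 ^ r
  ≤⟨ *-monoˡ-≤ (2 ^ r) h₂ ⟩
    2 ^ n * 2 ^ r ∎)
  where open ≤-Reasoning

sumUpTo-C>0 : ∀ t k → 0 < sumUpTo t (λ i → k C i)
sumUpTo-C>0 zero k = subst (0 <_) (sym (trans (+-identityʳ (k C 0)) (trans (nCk≡nC[n∸k] {0} {k} z≤n) (nCn≡1 k)))) (s≤s z≤n)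
sumUpTo-C>0 (suc t) k = ≤-trans (sumUpTo-C>0 t k) (≤-trans (m≤m+n _ (k C suc t)) (≤-reflexive (sym (sumUpTo-suc t (λ i → k C i)))))

2+2[2^[s∸1]∸1]≡2^s : ∀ s → 1 ≤ s → 2 + ((2 ^ (s ∸ 1) ∸ 1) + (2 ^ (s ∸ 1) ∸ 1)) ≡ 2 ^ s
2+2[2^[s∸1]∸1]≡2^s (suc s) _ with 2 ^ s in eq
... | zero = ⊥-elim (≢-nonZero⁻¹ (2 ^ s) {{2^-nonZero s}} eq)
... | suc x = cong suc (trans (sym (+-suc x x)) (cong (x +_) (sym (+-identityʳ (suc x)))))

2+2^[m∸1]+2^[m∸1]≡2^m+2 : ∀ m → 1 ≤ m → 2 + (2 ^ (m ∸ 1) + 2 ^ (m ∸ 1)) ≡ 2 ^ m + 2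
2+2^[m∸1]+2^[m∸1]≡2^m+2 (suc m) _ = trans (+-comm 2 _) (cong (_+ 2) (cong (2 ^ m +_) (sym (+-identityʳ (2 ^ m)))))

2+2[d/2∸1]≤d : ∀ d → 2 ≤ d → 2 + ((d / 2 ∸ 1) + (d / 2 ∸ 1)) ≤ d
2+2[d/2∸1]≤d d 2≤d with d / 2 in eq
... | zero with subst (1 ≤_) eq (/-mono-≤ 2≤d (≤-refl {2}))
...   | ()
2+2[d/2∸1]≤d d 2≤d | suc h = ≤-trans (≤-reflexive (solve 1 (λ h → con 2 :+ (h :+ h) := (con 1 :+ h) :* con 2) refl h))
  (subst (λ z → z * 2 ≤ d) eq (m/n*n≤m d 2))

2^m+4≤d⇒2^[m∸1]+1≤d/2∸1 : ∀ m d → 1 ≤ m → 2 ^ m + 4 ≤ d → 2 ^ (m ∸ 1) + 1 ≤ d / 2 ∸ 1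
2^m+4≤d⇒2^[m∸1]+1≤d/2∸1 (suc m) d _ le = m+n≤o⇒m≤o∸n (2 ^ m + 1) (begin
    2 ^ m + 1 + 1
  ≡⟨ trans (+-assoc (2 ^ m) 1 1) (sym (m*n/n≡m (2 ^ m + 2) 2)) ⟩
    (2 ^ m + 2) * 2 / 2
  ≤⟨ /-mono-≤ (≤-trans (≤-reflexive (solve 1 (λ a → (a :+ con 2) :* con 2 := con 2 :* a :+ con 4) refl (2 ^ m))) le) (≤-refl {2}) ⟩
    d / 2 ∎)
  where open ≤-Reasoning

2^m*2^s+2^s∸2^m≡2^[m+s]∸2^m+2^s : ∀ m s → 2 ^ m * 2 ^ s + 2 ^ s ∸ 2 ^ m ≡ 2 ^ (m + s) ∸ 2 ^ m + 2 ^ s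
2^m*2^s+2^s∸2^m≡2^[m+s]∸2^m+2^s m s = trans (+-∸-comm (2 ^ s) (m≤m*n (2 ^ m) (2 ^ s) {{2^-nonZero s}}))
  (cong (λ x → x ∸ 2 ^ m + 2 ^ s) (sym (^-distribˡ-+-* 2 m s)))

module _ {q : ℕ} (Π : ProjectivePlane q) (S : PtSet Π) (p₀ : Pt Π) (p₀∈S : S p₀ ≡ true) where
  open ProjectivePlane Π
  open ArcDesign Π S

  rank-sphere-bound : ∀ {r d} → IsRank₂ r → IsMinDist InC d → ∀ t → 2 + (t + t) ≤ d →
    2 ^ r * sumUpTo t (λ i → (count S ∸ 1) C i) ≤ 2 ^ (count S ∸ 1)
  rank-sphere-bound {r} (rs , blocks , independent , _) (_ , minimal) t 2t+2≤d =
    subst (λ k → k * sumUpTo t (λ i → (count S ∸ 1) C i) ≤ 2 ^ (count S ∸ 1)) (countWords-all r (λ _ → true) (λ _ → refl))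
      (punctured-sphere-packing S p₀ p₀∈S r (λ _ → true) (λ u → combination Π S rs (lookup u)) t
        (λ u _ → InC⇒supported Π S _ (combination∈C Π S rs blocks (lookup u))) separated)
    where
    separated : ∀ u u′ → true ≡ true → true ≡ true →
      count (λ p → combination Π S rs (lookup u) p xor combination Π S rs (lookup u′) p) ≤ suc (t + t) → u ≡ u′
    separated u u′ _ _ close with all? (λ p → combination Π S rs (lookup (u ⊕ u′)) p Bool.≟ false)
    ... | yes trivial = lookup-ext u u′ λ i →
            xor≡false⇒≡ (trans (sym (lookup-zipWith _xor_ i u u′)) (independent (lookup (u ⊕ u′)) trivial i))
    ... | no nonzero = ⊥-elim (<-irrefl refl (≤-trans 2t+2≤d
            (≤-trans (minimal _ (combination∈C Π S rs blocks (lookup (u ⊕ u′))) nonzero)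
              (≤-trans (≤-reflexive (count-cong difference)) close))))
      where
      difference : ∀ p → combination Π S rs (lookup (u ⊕ u′)) p ≡
                         combination Π S rs (lookup u) p xor combination Π S rs (lookup u′) p
      difference p = trans (combination-cong Π S rs (λ i → lookup-zipWith _xor_ i u u′) p)
                       (combination-xor Π S rs (lookup u) (lookup u′) p)

  rank-upper-bound : ∀ {n r d} → count S ≡ n → IsRank₂ r → IsMinDist InC d → ∀ t → 2 + (t + t) ≤ d →
    r ≤ n ∸ 1 ∸ ⌊log₂ sumUpTo t (λ i → (n ∸ 1) C i) ⌋
  rank-upper-bound {r = r} refl rank md t 2t+2≤d =
    2^*≤2^⇒≤∸⌊log₂⌋ r _ (count S ∸ 1) (sumUpTo-C>0 t (count S ∸ 1)) (rank-sphere-bound rank md t 2t+2≤d)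

  -- The words supported on S and orthogonal to the r basis rows form C⊥, a set of at least 2ⁿ⁻ʳ words.
  rank-lower-bound : ∀ {n r d⊥} → count S ≡ n → IsRank₂ r → IsMinDist InC⊥ d⊥ → ∀ t → 2 + (t + t) ≤ d⊥ →
    1 + ⌈log₂ sumUpTo t (λ i → (n ∸ 1) C i) ⌉ ≤ r
  rank-lower-bound {r = r} refl (rs , _ , _ , spans) (_ , minimal) t 2t+2≤d⊥ =
    2*≤2^⇒1+⌈log₂⌉≤ r _ (sumUpTo-C>0 t (count S ∸ 1))
      (2*≤2^-from-bounds (count S) r (countWords _ K) _ (witness⇒count>0 S p₀ p₀∈S)
        (countWords-orthogonalTo S (λ i → row (rs i)))
        (punctured-sphere-packing S p₀ p₀∈S _ K lookup t
           (λ u Ku → within-sound S u (proj₁ (orthogonalTo-sound S rows u Ku))) separated))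
    where
    rows = λ i → row (rs i)
    K = orthogonalTo S rows
    separated : ∀ u u′ → K u ≡ true → K u′ ≡ true → count (λ p → lookup u p xor lookup u′ p) ≤ suc (t + t) → u ≡ u′
    separated u u′ Ku Ku′ close with all? (λ p → lookup (u ⊕ u′) p Bool.≟ false)
    ... | yes u⊕u′≡0 = lookup-ext u u′ λ p → xor≡false⇒≡ (trans (sym (lookup-zipWith _xor_ p u u′)) (u⊕u′≡0 p))
    ... | no u⊕u′≢0 = ⊥-elim (<-irrefl refl (≤-trans 2t+2≤d⊥ (≤-trans (minimal _ u⊕u′∈C⊥ u⊕u′≢0)
                        (≤-trans (≤-reflexive (count-cong (λ p → lookup-zipWith _xor_ p u u′))) close))))
      where
      u⊕u′∈C⊥ : InC⊥ (lookup (u ⊕ u′))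
      u⊕u′∈C⊥ = within-sound S (u ⊕ u′) (within-⊕ S u u′ (proj₁ (orthogonalTo-sound S rows u Ku)) (proj₁ (orthogonalTo-sound S rows u′ Ku′))) ,
        orthogonal-to-span Π S rs spans (lookup (u ⊕ u′)) λ i → trans (·-⊕ u u′ (row (rs i)))
          (cong₂ _xor_ (proj₂ (orthogonalTo-sound S rows u Ku) i) (proj₂ (orthogonalTo-sound S rows u′ Ku′) i))



theorem2p3 : (m s : ℕ) → 1 ≤ s → s ≤ m →
    (Π : ProjectivePlane (2 ^ m)) → (S : PtSet Π) →
    IsMaximalArc Π (2 ^ s) S →
    let open ArcDesign Π S
        n = 2 ^ (m + s) ∸ 2 ^ m + 2 ^ s
    in (∃ λ d → IsMinDist InC d) × (∃ λ d⊥ → IsMinDist InC⊥ d⊥) × (∃ λ r → IsRank₂ r) ×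
       (∀ d d⊥ r → IsMinDist InC d → IsMinDist InC⊥ d⊥ → IsRank₂ r →
         -- (a)
         ((ContainsHyperoval → d⊥ ≡ 2 ^ m + 2) × (¬ ContainsHyperoval → 2 ^ m + 4 ≤ d⊥)) ×
         -- (b)
         ((2 ∣ d) × (d ≤ 2 ^ s) ×
          (d ≡ 2 ^ s →
            (r ≤ n ∸ 1 ∸ ⌊log₂ sumUpTo (2 ^ (s ∸ 1) ∸ 1) (λ i → (n ∸ 1) C i) ⌋) ×
            (ContainsHyperoval →
              1 + ⌈log₂ sumUpTo (2 ^ (m ∸ 1)) (λ i → (n ∸ 1) C i) ⌉ ≤ r) ×
            (¬ ContainsHyperoval →
              (2 ^ (m ∸ 1) + 1 ≤ d⊥ / 2 ∸ 1) ×
              (1 + ⌈log₂ sumUpTo (d⊥ / 2 ∸ 1) (λ i → (n ∸ 1) C i) ⌉ ≤ r)))))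
theorem2p3 m s 1≤s s≤m Π S arc@(|S| , _) =
  let (p₀ , p₀∈S) = count>0⇒witness S |S|>0
      (L₀ , L₀-block) = block-through-point Π S p₀ p₀∈S
      (r , rank@(rs , blocks , _ , spans)) = rank-exists Π S in
  minDist-exists Π S rs blocks spans L₀ L₀-block , minDist⊥-exists Π S S⊥ p₀ p₀∈S , (r , rank) ,
  λ d d⊥ r md md⊥ rank →
    (minDist⊥-hyperoval Π S md⊥ , minDist⊥-no-hyperoval Π S q-even md⊥) ,
    minDist-even Π S S⊥ md , subst (d ≤_) (block-size L₀ L₀-block) (minDist≤meet Π S md L₀ L₀-block) ,
    λ d≡2^s →
      rank-upper-bound Π S p₀ p₀∈S |S|≡n rank md (2 ^ (s ∸ 1) ∸ 1)
        (≤-reflexive (trans (2+2[2^[s∸1]∸1]≡2^s s 1≤s) (sym d≡2^s))) ,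
      (λ H → rank-lower-bound Π S p₀ p₀∈S |S|≡n rank md⊥ (2 ^ (m ∸ 1))
        (≤-reflexive (trans (2+2^[m∸1]+2^[m∸1]≡2^m+2 m 1≤m) (sym (minDist⊥-hyperoval Π S md⊥ H))))) ,
      (λ ¬H → let 2^m+4≤d⊥ = minDist⊥-no-hyperoval Π S q-even md⊥ ¬H in
        2^m+4≤d⇒2^[m∸1]+1≤d/2∸1 m d⊥ 1≤m 2^m+4≤d⊥ ,
        rank-lower-bound Π S p₀ p₀∈S |S|≡n rank md⊥ (d⊥ / 2 ∸ 1) (2+2[d/2∸1]≤d d⊥ (≤-trans (m≤n+m 2 (2 ^ m + 2))
          (subst (_≤ d⊥) (sym (+-assoc (2 ^ m) 2 2)) 2^m+4≤d⊥))))
  where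
  open ArcDesign Π S
  1≤m = ≤-trans 1≤s s≤m
  q-even = parity-2^ m 1≤m
  instance
    q≢0 : NonZero (2 ^ m)
    q≢0 = 2^-nonZero m
  block-size : ∀ L → IsBlock L → meet Π L S ≡ 2 ^ s
  block-size = maximalArc-meet Π (2 ^ s) S (m^n>0 2 s) arc
  S⊥ : InC⊥ S
  S⊥ = S∈C⊥ Π S (λ L b → trans (cong parity (block-size L b)) (parity-2^ s 1≤s))
  |S|≡n : count S ≡ 2 ^ (m + s) ∸ 2 ^ m + 2 ^ s
  |S|≡n = trans |S| (2^m*2^s+2^s∸2^m≡2^[m+s]∸2^m+2^s m s)
  |S|>0 : 0 < count S
  |S|>0 = subst (0 <_) (sym |S|≡n) (≤-trans (m^n>0 2 s) (m≤n+m _ _))
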